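{- Let $n$ be a positive integer and $p$ an odd prime. Let $S$ be a subset of $\mathbb{Z}_n$ with $0 \notin S$, $S = -S$, and $|S| = p$, such that the circulant graph $\mathrm{Cay}(\mathbb{Z}_n, S)$ is connected. Then $\mathrm{Cay}(\mathbb{Z}_n, S)$ admits a total perfect code if and only if $p$ divides $n$ and $s \not\equiv s' \pmod p$ for all distinct $s, s' \in S$.
   Context: For a finite group $G$ and an inverse-closed subset $X \subseteq G$ not containing the identity, the Cayley graph $\mathrm{Cay}(G,X)$ has vertex set $G$, with $u,v$ adjacent iff $vu^{ -1} \in X$. A circulant graph is a Cayley graph $\mathrm{Cay}(\mathbb{Z}_n, S)$ on the additive cyclic group $\mathbb{Z}_n$; its degree is $|S|$. A total perfect code in a graph $\Gamma=(V,E)$ is a subset $C \subseteq V$ such that every vertex of $\Gamma$ has exactly one neighbour in $C$. When $p \mid n$, congruence modulo $p$ of elements of $\mathbb{Z}_n$ is well defined. -}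

module Defs where

open import Data.Nat using (ℕ; _+_; _∸_; _%_; NonZero)
open import Data.Nat.DivMod using (_mod_)
open import Data.Fin using (Fin; toℕ; zero)
open import Data.Fin.Subset using (Subset; _∈_; _∉_; ∣_∣)
open import Data.Product using (∃; ∃!; _×_; Σ)
open import Relation.Binary.PropositionalEquality using (_≡_)
open import Relation.Binary.Construct.Closure.ReflexiveTransitive using (Star)
open import Relation.Nullary using (¬_)

module _ {n : ℕ} .{{_ : NonZero n}} where

  _+ₙ_ : Fin n → Fin n → Fin n
  a +ₙ b = (toℕ a + toℕ b) mod n

  -ₙ_ : Fin n → Fin n
  -ₙ a = (n ∸ toℕ a) mod n

  0ₙ : Fin n
  0ₙ = 0 mod n

  InverseClosed : Subset n → Set
  InverseClosed S = ∀ s → s ∈ S → (-ₙ s) ∈ S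

  Adj : Subset n → Fin n → Fin n → Set
  Adj S u v = (v +ₙ (-ₙ u)) ∈ S

  Connected : Subset n → Set
  Connected S = ∀ u v → Star (Adj S) u v

  TotalPerfectCode : Subset n → Subset n → Set
  TotalPerfectCode S C = ∀ v → ∃! _≡_ (λ c → c ∈ C × Adj S v c)

  HasTotalPerfectCode : Subset n → Set
  HasTotalPerfectCode S = ∃ λ C → TotalPerfectCode S C

module Submission where

-- Sufficiency: S meets every residue class mod p once, and the multiples of
-- p form a total perfect code.  Necessity: a total perfect code C is a
-- tiling S ⊕ C = ℤ_n, so p ∣ n; Tijdeman's multiplier theorem (t·S ⊕ C = ℤ_n
-- for t prime to |S|), proved from the Frobenius identity in the group
-- semiring ℕ[ℤ_n] modulo a prime, then shows that two congruent elements of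
-- S would give two representations of one element of some t·S ⊕ C.

open import Data.Nat using (ℕ; NonZero)
open import Data.Nat.Primality using (Prime)
open import Data.Fin.Subset using (Subset)

module IntegerCongruence where

  open import Data.Nat as ℕ using (suc)
  open import Data.Nat.DivMod using (_%_; _/_; m≡m%n+[m/n]*n; [m+kn]%n≡m%n; m<n⇒m%n≡m)
  open import Data.Integer using (ℤ; +_; -[1+_]; _+_; _-_; _*_; -_)
  import Data.Integer.Properties as ℤP
  open import Data.Integer.Divisibility.Signed using (_∣_; divides; ∣-trans)
  open import Data.Integer.Tactic.RingSolver using (solve; solve-∀)
  open import Data.List using (_∷_; [])
  open import Relation.Binary.Bundles using (Setoid)
  open import Relation.Binary.Structures using (IsEquivalence)
  open import Relation.Binary.PropositionalEquality

  infix 4 _≋[_]_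
  -- a ≋[ k ] b  means  a ≡ b (mod k).  A record, so that k stays inferable.
  record _≋[_]_ (a k b : ℤ) : Set where
    constructor mk≋
    field un≋ : k ∣ (a - b)
  open _≋[_]_ public

  module _ {k : ℤ} where

    ≋-refl : ∀ {a} → a ≋[ k ] a
    ≋-refl {a} = mk≋ (divides (+ 0) (trans (ℤP.+-inverseʳ a) (sym (ℤP.*-zeroˡ k))))

    ≋-reflexive : ∀ {a b} → a ≡ b → a ≋[ k ] b
    ≋-reflexive refl = ≋-refl

    ≋-sym : ∀ {a b} → a ≋[ k ] b → b ≋[ k ] a
    ≋-sym {a} {b} (mk≋ (divides q eq)) = mk≋ (divides (- q) (begin
        b - a      ≡⟨ solve (a ∷ b ∷ []) ⟩
        - (a - b)  ≡⟨ cong -_ eq ⟩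
        - (q * k)  ≡⟨ ℤP.neg-distribˡ-* q k ⟩
        - q * k    ∎))
      where open ≡-Reasoning

    ≋-trans : ∀ {a b c} → a ≋[ k ] b → b ≋[ k ] c → a ≋[ k ] c
    ≋-trans {a} {b} {c} (mk≋ (divides q eq)) (mk≋ (divides r eq')) = mk≋ (divides (q + r) (begin
        a - c              ≡⟨ solve (a ∷ b ∷ c ∷ []) ⟩
        (a - b) + (b - c)  ≡⟨ cong₂ _+_ eq eq' ⟩
        q * k + r * k      ≡⟨ ℤP.*-distribʳ-+ k q r ⟨
        (q + r) * k        ∎))
      where open ≡-Reasoning

    ≋-isEquivalence : IsEquivalence _≋[ k ]_
    ≋-isEquivalence = record { refl = ≋-refl ; sym = ≋-sym ; trans = ≋-trans }

    ≋-setoid : Setoid _ _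
    ≋-setoid = record { isEquivalence = ≋-isEquivalence }

    ≋-+ : ∀ {a b c d} → a ≋[ k ] b → c ≋[ k ] d → a + c ≋[ k ] b + d
    ≋-+ {a} {b} {c} {d} (mk≋ (divides q eq)) (mk≋ (divides r eq')) = mk≋ (divides (q + r) (begin
        (a + c) - (b + d)  ≡⟨ solve (a ∷ b ∷ c ∷ d ∷ []) ⟩
        (a - b) + (c - d)  ≡⟨ cong₂ _+_ eq eq' ⟩
        q * k + r * k      ≡⟨ ℤP.*-distribʳ-+ k q r ⟨
        (q + r) * k        ∎))
      where open ≡-Reasoning

    ≋-neg : ∀ {a b} → a ≋[ k ] b → - a ≋[ k ] - b
    ≋-neg {a} {b} (mk≋ (divides q eq)) = mk≋ (divides (- q) (begin
        - a - - b  ≡⟨ solve (a ∷ b ∷ []) ⟩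
        - (a - b)  ≡⟨ cong -_ eq ⟩
        - (q * k)  ≡⟨ ℤP.neg-distribˡ-* q k ⟩
        - q * k    ∎))
      where open ≡-Reasoning

    ≋-- : ∀ {a b c d} → a ≋[ k ] b → c ≋[ k ] d → a - c ≋[ k ] b - d
    ≋-- a≋b c≋d = ≋-+ a≋b (≋-neg c≋d)

    ≋-*ˡ : ∀ c {a b} → a ≋[ k ] b → c * a ≋[ k ] c * b
    ≋-*ˡ c {a} {b} (mk≋ (divides q eq)) = mk≋ (divides (c * q) (begin
        c * a - c * b  ≡⟨ solve (a ∷ b ∷ c ∷ []) ⟩
        c * (a - b)    ≡⟨ cong (c *_) eq ⟩
        c * (q * k)    ≡⟨ ℤP.*-assoc c q k ⟨
        c * q * k      ∎))
      where open ≡-Reasoning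

    ≋-*ʳ : ∀ c {a b} → a ≋[ k ] b → a * c ≋[ k ] b * c
    ≋-*ʳ c {a} {b} a≋b =
      ≋-trans (≋-reflexive (ℤP.*-comm a c)) (≋-trans (≋-*ˡ c a≋b) (≋-reflexive (ℤP.*-comm c b)))

    ∣⇒≋0 : ∀ {a} → k ∣ a → a ≋[ k ] + 0
    ∣⇒≋0 {a} d = mk≋ (subst (k ∣_) (sym (ℤP.+-identityʳ a)) d)

    ≋0⇒∣ : ∀ {a} → a ≋[ k ] + 0 → k ∣ a
    ≋0⇒∣ {a} (mk≋ d) = subst (k ∣_) (ℤP.+-identityʳ a) d

    diff≋0⇒≋ : ∀ {a b} → a - b ≋[ k ] + 0 → a ≋[ k ] b
    diff≋0⇒≋ a-b≋0 = mk≋ (≋0⇒∣ a-b≋0)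

    ≋-weaken : ∀ {d a b} → d ∣ k → a ≋[ k ] b → a ≋[ d ] b
    ≋-weaken d∣k (mk≋ k∣a-b) = mk≋ (∣-trans d∣k k∣a-b)

  ≋-scale : ∀ {k a b} c → a ≋[ k ] b → c * a ≋[ c * k ] c * b
  ≋-scale {k} {a} {b} c (mk≋ (divides q eq)) = mk≋ (divides q (begin
      c * a - c * b  ≡⟨ solve (a ∷ b ∷ c ∷ []) ⟩
      c * (a - b)    ≡⟨ cong (c *_) eq ⟩
      c * (q * k)    ≡⟨ solve (c ∷ q ∷ k ∷ []) ⟩
      q * (c * k)    ∎))
    where open ≡-Reasoning

  module _ (m : ℕ) .{{_ : NonZero m}} where

    %-≋ : ∀ x → + (x % m) ≋[ + m ] + x
    %-≋ x = mk≋ (divides (- + (x / m)) (begin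
        + (x % m) - + x                           ≡⟨ cong (λ z → + (x % m) - + z) (m≡m%n+[m/n]*n x m) ⟩
        + (x % m) - + (x % m ℕ.+ x / m ℕ.* m)     ≡⟨ cong (λ z → + (x % m) - z) (ℤP.pos-+ (x % m) (x / m ℕ.* m)) ⟩
        + (x % m) - (+ (x % m) + + (x / m ℕ.* m)) ≡⟨ cong (λ z → + (x % m) - (+ (x % m) + z)) (ℤP.pos-* (x / m) m) ⟩
        + (x % m) - (+ (x % m) + + (x / m) * + m) ≡⟨ cancel (+ (x % m)) (+ (x / m)) (+ m) ⟩
        - + (x / m) * + m                         ∎))
      where
      open ≡-Reasoning
      cancel : ∀ r q m → r - (r + q * m) ≡ - q * m
      cancel = solve-∀

    %-+multiple : ∀ x y q → + y - + x ≡ + q * + m → y % m ≡ x % m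
    %-+multiple x y q eq = trans (cong (_% m) y≡) ([m+kn]%n≡m%n x q m)
      where
      open ≡-Reasoning
      regroup : ∀ a b → b ≡ a + (b - a)
      regroup = solve-∀
      y≡ : y ≡ x ℕ.+ q ℕ.* m
      y≡ = ℤP.+-injective (begin
        + y                    ≡⟨ regroup (+ x) (+ y) ⟩
        + x + (+ y - + x)      ≡⟨ cong (λ z → + x + z) eq ⟩
        + x + + q * + m        ≡⟨ cong (λ z → + x + z) (ℤP.pos-* q m) ⟨
        + x + + (q ℕ.* m)      ≡⟨ ℤP.pos-+ x (q ℕ.* m) ⟨
        + (x ℕ.+ q ℕ.* m)      ∎)

    ≋⇒% : ∀ x y → + x ≋[ + m ] + y → x % m ≡ y % m
    ≋⇒% x y (mk≋ (divides (+ q) eq)) = %-+multiple y x q eq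
    ≋⇒% x y (mk≋ (divides -[1+ q ] eq)) = sym (%-+multiple x y (suc q) (begin
        + y - + x                ≡⟨ swap (+ x) (+ y) ⟩
        - (+ x - + y)            ≡⟨ cong -_ eq ⟩
        - (-[1+ q ] * + m)       ≡⟨ ℤP.neg-distribˡ-* -[1+ q ] (+ m) ⟩
        + suc q * + m            ∎))
      where
      open ≡-Reasoning
      swap : ∀ a b → b - a ≡ - (a - b)
      swap = solve-∀

    %⇒≋ : ∀ x y → x % m ≡ y % m → + x ≋[ + m ] + y
    %⇒≋ x y e = ≋-trans (≋-sym (%-≋ x)) (≋-trans (≋-reflexive (cong +_ e)) (%-≋ y))

    small-≋⇒≡ : ∀ {x y} → x ℕ.< m → y ℕ.< m → + x ≋[ + m ] + y → x ≡ y
    small-≋⇒≡ {x} {y} x<m y<m x≋y = trans (sym (m<n⇒m%n≡m x<m)) (trans (≋⇒% x y x≋y) (m<n⇒m%n≡m y<m))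

-- The group ℤ_n of Defs (carrier Fin n, operations reduced mod n) is
-- related to ℤ through ι a = + toℕ a: ι is a homomorphism modulo n and is
-- injective modulo n, so identities in ℤ_n follow from identities in ℤ.
module CyclicGroup (n : ℕ) .{{_ : NonZero n}} where

  open import Data.Nat as ℕ using (suc)
  open import Data.Nat.DivMod using (_%_; _mod_; m<n⇒m%n≡m)
  open import Data.Integer using (ℤ; +_; _+_; _-_; _*_; -_; _⊖_)
  import Data.Integer.Properties as ℤP
  open import Data.Integer.Divisibility.Signed using (∣-refl)
  open import Data.Integer.Tactic.RingSolver using (solve-∀)
  open import Data.Fin using (Fin; toℕ)
  import Data.Fin.Properties as FP
  open import Relation.Binary.PropositionalEquality
  import Relation.Binary.Reasoning.Setoid as SetoidReasoning
  open import Defs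
  open IntegerCongruence

  ι : Fin n → ℤ
  ι a = + toℕ a

  infix 4 _≈n_
  _≈n_ : ℤ → ℤ → Set
  a ≈n b = a ≋[ + n ] b

  module ≈n-Reasoning = SetoidReasoning (≋-setoid {+ n})

  ι-mod : ∀ x → ι (x mod n) ≈n + x
  ι-mod x = ≋-trans (≋-reflexive (cong +_ (FP.toℕ-fromℕ< _))) (%-≋ n x)

  ι-inj : ∀ {a b} → ι a ≈n ι b → a ≡ b
  ι-inj {a} {b} ιa≈ιb = FP.toℕ-injective (begin
      toℕ a      ≡⟨ m<n⇒m%n≡m (FP.toℕ<n a) ⟨
      toℕ a % n  ≡⟨ ≋⇒% n (toℕ a) (toℕ b) ιa≈ιb ⟩
      toℕ b % n  ≡⟨ m<n⇒m%n≡m (FP.toℕ<n b) ⟩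
      toℕ b      ∎)
    where open ≡-Reasoning

  ι-0 : ι 0ₙ ≈n + 0
  ι-0 = ι-mod 0

  ι-+ : ∀ a b → ι (a +ₙ b) ≈n ι a + ι b
  ι-+ a b = ≋-trans (ι-mod (toℕ a ℕ.+ toℕ b)) (≋-reflexive (ℤP.pos-+ (toℕ a) (toℕ b)))

  ι-neg : ∀ a → ι (-ₙ a) ≈n - ι a
  ι-neg a = begin
      ι (-ₙ a)               ≈⟨ ι-mod (n ℕ.∸ toℕ a) ⟩
      + (n ℕ.∸ toℕ a)        ≡⟨ ℤP.⊖-≥ (FP.toℕ≤n a) ⟨
      n ⊖ toℕ a              ≡⟨ ℤP.m-n≡m⊖n n (toℕ a) ⟨
      + n - ι a              ≈⟨ ≋-- n≈0 (≋-refl {a = ι a}) ⟩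
      + 0 - ι a              ≡⟨ ℤP.+-identityˡ (- ι a) ⟩
      - ι a                  ∎
    where
    open ≈n-Reasoning
    n≈0 : + n ≈n + 0
    n≈0 = ∣⇒≋0 ∣-refl

  infixl 6 _-ₙ_
  _-ₙ_ : Fin n → Fin n → Fin n
  a -ₙ b = a +ₙ (-ₙ b)

  ι-- : ∀ a b → ι (a -ₙ b) ≈n ι a - ι b
  ι-- a b = ≋-trans (ι-+ a (-ₙ b)) (≋-+ (≋-refl {a = ι a}) (ι-neg b))

  infixl 7 _·ₙ_
  _·ₙ_ : ℕ → Fin n → Fin n
  t ·ₙ a = (t ℕ.* toℕ a) mod n

  ι-· : ∀ t a → ι (t ·ₙ a) ≈n + t * ι a
  ι-· t a = ≋-trans (ι-mod (t ℕ.* toℕ a)) (≋-reflexive (ℤP.pos-* t (toℕ a)))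

  x-[x-y]≡y : ∀ x y → x -ₙ (x -ₙ y) ≡ y
  x-[x-y]≡y x y = ι-inj (begin
      ι (x -ₙ (x -ₙ y))  ≈⟨ ι-- x (x -ₙ y) ⟩
      ι x - ι (x -ₙ y)   ≈⟨ ≋-- (≋-refl {a = ι x}) (ι-- x y) ⟩
      ι x - (ι x - ι y)  ≡⟨ identity (ι x) (ι y) ⟩
      ι y                ∎)
    where
    open ≈n-Reasoning
    identity : ∀ a b → a - (a - b) ≡ b
    identity = solve-∀

  [w+z]-z≡w : ∀ w z → (w +ₙ z) -ₙ z ≡ w
  [w+z]-z≡w w z = ι-inj (begin
      ι ((w +ₙ z) -ₙ z)   ≈⟨ ι-- (w +ₙ z) z ⟩
      ι (w +ₙ z) - ι z    ≈⟨ ≋-- (ι-+ w z) (≋-refl {a = ι z}) ⟩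
      (ι w + ι z) - ι z   ≡⟨ identity (ι w) (ι z) ⟩
      ι w                 ∎)
    where
    open ≈n-Reasoning
    identity : ∀ a b → (a + b) - b ≡ a
    identity = solve-∀

  [y-z]+z≡y : ∀ y z → (y -ₙ z) +ₙ z ≡ y
  [y-z]+z≡y y z = ι-inj (begin
      ι ((y -ₙ z) +ₙ z)   ≈⟨ ι-+ (y -ₙ z) z ⟩
      ι (y -ₙ z) + ι z    ≈⟨ ≋-+ (ι-- y z) (≋-refl {a = ι z}) ⟩
      (ι y - ι z) + ι z   ≡⟨ identity (ι y) (ι z) ⟩
      ι y                 ∎)
    where
    open ≈n-Reasoning
    identity : ∀ a b → (a - b) + b ≡ a
    identity = solve-∀

  x-[w+z]≡x-z-w : ∀ x w z → x -ₙ (w +ₙ z) ≡ (x -ₙ z) -ₙ w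
  x-[w+z]≡x-z-w x w z = ι-inj (begin
      ι (x -ₙ (w +ₙ z))       ≈⟨ ι-- x (w +ₙ z) ⟩
      ι x - ι (w +ₙ z)        ≈⟨ ≋-- (≋-refl {a = ι x}) (ι-+ w z) ⟩
      ι x - (ι w + ι z)       ≡⟨ identity (ι x) (ι w) (ι z) ⟩
      (ι x - ι z) - ι w       ≈⟨ ≋-- (ι-- x z) (≋-refl {a = ι w}) ⟨
      ι (x -ₙ z) - ι w        ≈⟨ ι-- (x -ₙ z) w ⟨
      ι ((x -ₙ z) -ₙ w)       ∎)
    where
    open ≈n-Reasoning
    identity : ∀ a b c → a - (b + c) ≡ (a - c) - b
    identity = solve-∀

  x-0≡x : ∀ x → x -ₙ 0ₙ ≡ x
  x-0≡x x = ι-inj (begin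
      ι (x -ₙ 0ₙ)   ≈⟨ ι-- x 0ₙ ⟩
      ι x - ι 0ₙ    ≈⟨ ≋-- (≋-refl {a = ι x}) ι-0 ⟩
      ι x - + 0     ≡⟨ ℤP.+-identityʳ (ι x) ⟩
      ι x           ∎)
    where open ≈n-Reasoning

  a+[x-a]≡x : ∀ a x → a +ₙ (x -ₙ a) ≡ x
  a+[x-a]≡x a x = ι-inj (begin
      ι (a +ₙ (x -ₙ a))   ≈⟨ ι-+ a (x -ₙ a) ⟩
      ι a + ι (x -ₙ a)    ≈⟨ ≋-+ (≋-refl {a = ι a}) (ι-- x a) ⟩
      ι a + (ι x - ι a)   ≡⟨ identity (ι a) (ι x) ⟩
      ι x                 ∎)
    where
    open ≈n-Reasoning
    identity : ∀ a x → a + (x - a) ≡ x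
    identity = solve-∀

  [a+b]-a≡b : ∀ a b → (a +ₙ b) -ₙ a ≡ b
  [a+b]-a≡b a b = ι-inj (begin
      ι ((a +ₙ b) -ₙ a)   ≈⟨ ι-- (a +ₙ b) a ⟩
      ι (a +ₙ b) - ι a    ≈⟨ ≋-- (ι-+ a b) (≋-refl {a = ι a}) ⟩
      (ι a + ι b) - ι a   ≡⟨ identity (ι a) (ι b) ⟩
      ι b                 ∎)
    where
    open ≈n-Reasoning
    identity : ∀ a b → (a + b) - a ≡ b
    identity = solve-∀

  -[x-y]≡y-x : ∀ x y → -ₙ (x -ₙ y) ≡ y -ₙ x
  -[x-y]≡y-x x y = ι-inj (begin
      ι (-ₙ (x -ₙ y))   ≈⟨ ι-neg (x -ₙ y) ⟩
      - ι (x -ₙ y)      ≈⟨ ≋-neg (ι-- x y) ⟩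
      - (ι x - ι y)     ≡⟨ identity (ι x) (ι y) ⟩
      ι y - ι x         ≈⟨ ι-- y x ⟨
      ι (y -ₙ x)        ∎)
    where
    open ≈n-Reasoning
    identity : ∀ a b → - (a - b) ≡ b - a
    identity = solve-∀

  0·a≡0 : ∀ a → 0 ·ₙ a ≡ 0ₙ
  0·a≡0 a = ι-inj (begin
      ι (0 ·ₙ a)   ≈⟨ ι-· 0 a ⟩
      + 0 * ι a    ≡⟨ ℤP.*-zeroˡ (ι a) ⟩
      + 0          ≈⟨ ι-0 ⟨
      ι 0ₙ         ∎)
    where open ≈n-Reasoning

  1·a≡a : ∀ a → 1 ·ₙ a ≡ a
  1·a≡a a = ι-inj (≋-trans (ι-· 1 a) (≋-reflexive (ℤP.*-identityˡ (ι a))))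

  [1+k]·a≡a+k·a : ∀ k a → suc k ·ₙ a ≡ a +ₙ (k ·ₙ a)
  [1+k]·a≡a+k·a k a = ι-inj (begin
      ι (suc k ·ₙ a)          ≈⟨ ι-· (suc k) a ⟩
      + suc k * ι a           ≡⟨ cong (_* ι a) (ℤP.pos-+ 1 k) ⟩
      (+ 1 + + k) * ι a       ≡⟨ identity (+ k) (ι a) ⟩
      ι a + + k * ι a         ≈⟨ ≋-+ (≋-refl {a = ι a}) (ι-· k a) ⟨
      ι a + ι (k ·ₙ a)        ≈⟨ ι-+ a (k ·ₙ a) ⟨
      ι (a +ₙ (k ·ₙ a))       ∎)
    where
    open ≈n-Reasoning
    identity : ∀ k a → (+ 1 + k) * a ≡ a + k * a
    identity = solve-∀

  q·[t·a]≡[q*t]·a : ∀ q t a → q ·ₙ (t ·ₙ a) ≡ (q ℕ.* t) ·ₙ a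
  q·[t·a]≡[q*t]·a q t a = ι-inj (begin
      ι (q ·ₙ (t ·ₙ a))     ≈⟨ ι-· q (t ·ₙ a) ⟩
      + q * ι (t ·ₙ a)      ≈⟨ ≋-*ˡ (+ q) (ι-· t a) ⟩
      + q * (+ t * ι a)     ≡⟨ ℤP.*-assoc (+ q) (+ t) (ι a) ⟨
      + q * + t * ι a       ≡⟨ cong (_* ι a) (ℤP.pos-* q t) ⟨
      + (q ℕ.* t) * ι a     ≈⟨ ι-· (q ℕ.* t) a ⟨
      ι ((q ℕ.* t) ·ₙ a)    ∎)
    where open ≈n-Reasoning

module FiniteSums where

  open import Data.Nat using (zero; suc; _+_; _*_; _≤_; z≤n; s≤s)
  import Data.Nat.Properties as ℕP
  open import Data.Bool using (if_then_else_)
  open import Data.Fin using (Fin)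
  import Data.Fin.Properties as FP
  open import Data.Fin.Permutation using (permutation)
  open import Data.Product using (∃; _×_; _,_)
  open import Data.Empty using (⊥-elim)
  open import Relation.Nullary using (Dec; yes; no; does)
  open import Relation.Nullary.Decidable using (_×-dec_)
  open import Relation.Binary.PropositionalEquality
  import Algebra.Properties.Semiring.Sum ℕP.+-*-semiring as NatSum

  open NatSum public using (sum-cong-≗; ∑-distrib-+; ∑-comm; *-distribˡ-sum; *-distribʳ-sum;
                            sum-replicate-zero; sum-init-last)
    renaming (sum to Σ)

  𝟙 : ∀ {a} {P : Set a} → Dec P → ℕ
  𝟙 d = if does d then 1 else 0

  𝟙-yes : ∀ {a} {P : Set a} (d : Dec P) → P → 𝟙 d ≡ 1
  𝟙-yes (yes _) _ = refl
  𝟙-yes (no ¬p) p = ⊥-elim (¬p p)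

  𝟙≤1 : ∀ {a} {P : Set a} (d : Dec P) → 𝟙 d ≤ 1
  𝟙≤1 (yes _) = s≤s z≤n
  𝟙≤1 (no _) = z≤n

  𝟙-pos : ∀ {a} {P : Set a} (d : Dec P) → 1 ≤ 𝟙 d → P
  𝟙-pos (yes p) _ = p
  𝟙-pos (no _) ()

  𝟙-⇔ : ∀ {a b} {P : Set a} {Q : Set b} (d : Dec P) (e : Dec Q) → (P → Q) → (Q → P) → 𝟙 d ≡ 𝟙 e
  𝟙-⇔ (yes p) (yes q) _ _ = refl
  𝟙-⇔ (yes p) (no ¬q) f _ = ⊥-elim (¬q (f p))
  𝟙-⇔ (no ¬p) (yes q) _ g = ⊥-elim (¬p (g q))
  𝟙-⇔ (no ¬p) (no ¬q) _ _ = refl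

  *-pos : ∀ {x y} → 1 ≤ x * y → 1 ≤ x × 1 ≤ y
  *-pos {zero} ()
  *-pos {suc x} {zero} 1≤x*0 = ⊥-elim (ℕP.<⇒≱ 1≤x*0 (ℕP.≤-reflexive (ℕP.*-zeroʳ (suc x))))
  *-pos {suc x} {suc y} _ = s≤s z≤n , s≤s z≤n

  ≤1⇒≤ : ∀ {a b} → a ≤ 1 → (1 ≤ a → 1 ≤ b) → a ≤ b
  ≤1⇒≤ {zero} _ _ = z≤n
  ≤1⇒≤ {suc zero} _ pos = pos (s≤s z≤n)
  ≤1⇒≤ {suc (suc _)} (s≤s ()) _

  𝟙-× : ∀ {a b} {P : Set a} {Q : Set b} (d : Dec P) (e : Dec Q) → 𝟙 d * 𝟙 e ≡ 𝟙 (d ×-dec e)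
  𝟙-× (yes _) (yes _) = refl
  𝟙-× (yes _) (no _) = refl
  𝟙-× (no _) _ = refl

  Σ-1 : ∀ k → Σ {k} (λ _ → 1) ≡ k
  Σ-1 zero = refl
  Σ-1 (suc k) = cong suc (Σ-1 k)

  Σ-δ : ∀ {k} (a : Fin k) (f : Fin k → ℕ) → Σ (λ y → 𝟙 (y FP.≟ a) * f y) ≡ f a
  Σ-δ {suc k} Fin.zero f = trans (cong₂ _+_ (ℕP.*-identityˡ _) (sum-replicate-zero k)) (ℕP.+-identityʳ _)
  Σ-δ {suc k} (Fin.suc a) f = Σ-δ a (λ y → f (Fin.suc y))

  Σ-𝟙 : ∀ {k} (a : Fin k) → Σ (λ y → 𝟙 (y FP.≟ a)) ≡ 1
  Σ-𝟙 a = trans (sum-cong-≗ (λ y → sym (ℕP.*-identityʳ (𝟙 (y FP.≟ a))))) (Σ-δ a (λ _ → 1))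

  Σ-reindex : ∀ {k} (π π⁻¹ : Fin k → Fin k) → (∀ i → π (π⁻¹ i) ≡ i) → (∀ i → π⁻¹ (π i) ≡ i) →
              (f : Fin k → ℕ) → Σ f ≡ Σ (λ i → f (π i))
  Σ-reindex π π⁻¹ l r f = NatSum.sum-permute f (permutation π π⁻¹ l r)

  ≤Σ : ∀ {k} (f : Fin k → ℕ) (a : Fin k) → f a ≤ Σ f
  ≤Σ f Fin.zero = ℕP.m≤m+n _ _
  ≤Σ f (Fin.suc a) = ℕP.≤-trans (≤Σ (λ i → f (Fin.suc i)) a) (ℕP.m≤n+m _ (f Fin.zero))

  Σ-mono : ∀ {k} (f g : Fin k → ℕ) → (∀ i → f i ≤ g i) → Σ f ≤ Σ g
  Σ-mono {zero} f g f≤g = z≤n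
  Σ-mono {suc k} f g f≤g =
    ℕP.+-mono-≤ (f≤g Fin.zero) (Σ-mono (λ i → f (Fin.suc i)) (λ i → g (Fin.suc i)) (λ i → f≤g (Fin.suc i)))

  Σ-mono-tight : ∀ {k} (f g : Fin k → ℕ) → (∀ i → f i ≤ g i) → Σ g ≤ Σ f → ∀ i → f i ≡ g i
  Σ-mono-tight {suc k} f g f≤g Σg≤Σf = pointwise
    where
    f′ g′ : Fin k → ℕ
    f′ i = f (Fin.suc i)
    g′ i = g (Fin.suc i)
    Σf′≤Σg′ : Σ f′ ≤ Σ g′
    Σf′≤Σg′ = Σ-mono f′ g′ (λ i → f≤g (Fin.suc i))
    head≡ : f Fin.zero ≡ g Fin.zero
    head≡ = ℕP.≤-antisym (f≤g Fin.zero)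
      (ℕP.+-cancelʳ-≤ (Σ g′) _ _ (ℕP.≤-trans Σg≤Σf (ℕP.+-monoʳ-≤ (f Fin.zero) Σf′≤Σg′)))
    Σg′≤Σf′ : Σ g′ ≤ Σ f′
    Σg′≤Σf′ = ℕP.+-cancelˡ-≤ (g Fin.zero) _ _ (subst (λ z → Σ g ≤ z + Σ f′) head≡ Σg≤Σf)
    pointwise : ∀ i → f i ≡ g i
    pointwise Fin.zero = head≡
    pointwise (Fin.suc i) = Σ-mono-tight f′ g′ (λ j → f≤g (Fin.suc j)) Σg′≤Σf′ i

  Σ-pos : ∀ {k} (f : Fin k → ℕ) → 1 ≤ Σ f → ∃ λ i → 1 ≤ f i
  Σ-pos {zero} f ()
  Σ-pos {suc k} f 1≤Σf with f Fin.zero in f₀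
  ... | suc _ = Fin.zero , subst (1 ≤_) (sym f₀) (s≤s z≤n)
  ... | zero with Σ-pos (λ i → f (Fin.suc i)) 1≤Σf
  ...   | i , 1≤fi = Fin.suc i , 1≤fi

  Σ≥2 : ∀ {k} (f : Fin k → ℕ) (a b : Fin k) → a ≢ b → 1 ≤ f a → 1 ≤ f b → 2 ≤ Σ f
  Σ≥2 f Fin.zero Fin.zero a≢b _ _ = ⊥-elim (a≢b refl)
  Σ≥2 f Fin.zero (Fin.suc b) _ 1≤fa 1≤fb =
    ℕP.+-mono-≤ 1≤fa (ℕP.≤-trans 1≤fb (≤Σ (λ i → f (Fin.suc i)) b))
  Σ≥2 f (Fin.suc a) Fin.zero _ 1≤fa 1≤fb =
    ℕP.+-mono-≤ 1≤fb (ℕP.≤-trans 1≤fa (≤Σ (λ i → f (Fin.suc i)) a))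
  Σ≥2 f (Fin.suc a) (Fin.suc b) a≢b 1≤fa 1≤fb =
    ℕP.≤-trans (Σ≥2 (λ i → f (Fin.suc i)) a b (λ e → a≢b (cong Fin.suc e)) 1≤fa 1≤fb) (ℕP.m≤n+m _ (f Fin.zero))

  Σ≤1 : ∀ {k} (f : Fin k → ℕ) → (∀ i → f i ≤ 1) → (∀ i j → 1 ≤ f i → 1 ≤ f j → i ≡ j) → Σ f ≤ 1
  Σ≤1 f f≤1 unique with Σ f in eq
  ... | zero = z≤n
  ... | suc _ with Σ-pos f (subst (1 ≤_) (sym eq) (s≤s z≤n))
  ...   | i₀ , 1≤fi₀ = subst (_≤ 1) eq (ℕP.≤-trans (Σ-mono f (λ i → 𝟙 (i FP.≟ i₀)) bound) (ℕP.≤-reflexive (Σ-𝟙 i₀)))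
    where
    bound : ∀ i → f i ≤ 𝟙 (i FP.≟ i₀)
    bound i = ≤1⇒≤ (f≤1 i) (λ 1≤fi → ℕP.≤-reflexive (sym (𝟙-yes (i FP.≟ i₀) (unique i i₀ 1≤fi 1≤fi₀))))

module GroupSemiring (n : ℕ) .{{_ : NonZero n}} where

  open import Data.Nat using (_+_; _*_)
  import Data.Nat.Properties as ℕP
  open import Data.Fin using (Fin)
  import Data.Fin.Properties as FP
  open import Relation.Binary.PropositionalEquality
  open import Defs
  open CyclicGroup n
  open FiniteSums

  Fn : Set
  Fn = Fin n → ℕ

  infixl 7 _⋆_
  _⋆_ : Fn → Fn → Fn
  (f ⋆ g) x = Σ (λ y → f y * g (x -ₙ y))

  δ : Fin n → Fn
  δ a x = 𝟙 (x FP.≟ a)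

  Σ-reflect : ∀ x (f : Fn) → Σ f ≡ Σ (λ y → f (x -ₙ y))
  Σ-reflect x = Σ-reindex (λ y → x -ₙ y) (λ y → x -ₙ y) (x-[x-y]≡y x) (x-[x-y]≡y x)

  Σ-translate : ∀ z (f : Fn) → Σ f ≡ Σ (λ w → f (w +ₙ z))
  Σ-translate z = Σ-reindex (λ w → w +ₙ z) (λ y → y -ₙ z) (λ y → [y-z]+z≡y y z) (λ w → [w+z]-z≡w w z)

  Σ-translate⁻ : ∀ z (f : Fn) → Σ f ≡ Σ (λ w → f (w -ₙ z))
  Σ-translate⁻ z = Σ-reindex (λ w → w -ₙ z) (λ y → y +ₙ z) (λ w → [w+z]-z≡w w z) (λ y → [y-z]+z≡y y z)

  ⋆-comm : ∀ f g x → (f ⋆ g) x ≡ (g ⋆ f) x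
  ⋆-comm f g x = begin
      Σ (λ y → f y * g (x -ₙ y))                   ≡⟨ Σ-reflect x (λ y → f y * g (x -ₙ y)) ⟩
      Σ (λ y → f (x -ₙ y) * g (x -ₙ (x -ₙ y)))      ≡⟨ sum-cong-≗ swap ⟩
      Σ (λ y → g y * f (x -ₙ y))                   ∎
    where
    open ≡-Reasoning
    swap : ∀ y → f (x -ₙ y) * g (x -ₙ (x -ₙ y)) ≡ g y * f (x -ₙ y)
    swap y = trans (cong (λ z → f (x -ₙ y) * g z) (x-[x-y]≡y x y)) (ℕP.*-comm (f (x -ₙ y)) (g y))

  ⋆-assoc : ∀ f g h x → ((f ⋆ g) ⋆ h) x ≡ (f ⋆ (g ⋆ h)) x
  ⋆-assoc f g h x = begin
      Σ (λ y → Σ (λ z → f z * g (y -ₙ z)) * h (x -ₙ y))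
        ≡⟨ sum-cong-≗ (λ y → *-distribʳ-sum (h (x -ₙ y)) (λ z → f z * g (y -ₙ z))) ⟩
      Σ (λ y → Σ (λ z → f z * g (y -ₙ z) * h (x -ₙ y)))
        ≡⟨ ∑-comm (λ y z → f z * g (y -ₙ z) * h (x -ₙ y)) ⟩
      Σ (λ z → Σ (λ y → f z * g (y -ₙ z) * h (x -ₙ y)))
        ≡⟨ sum-cong-≗ (λ z → sum-cong-≗ (λ y → ℕP.*-assoc (f z) (g (y -ₙ z)) (h (x -ₙ y)))) ⟩
      Σ (λ z → Σ (λ y → f z * (g (y -ₙ z) * h (x -ₙ y))))
        ≡⟨ sum-cong-≗ (λ z → *-distribˡ-sum (f z) (λ y → g (y -ₙ z) * h (x -ₙ y))) ⟨
      Σ (λ z → f z * Σ (λ y → g (y -ₙ z) * h (x -ₙ y)))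
        ≡⟨ sum-cong-≗ (λ z → cong (f z *_) (Σ-translate z (λ y → g (y -ₙ z) * h (x -ₙ y)))) ⟩
      Σ (λ z → f z * Σ (λ w → g ((w +ₙ z) -ₙ z) * h (x -ₙ (w +ₙ z))))
        ≡⟨ sum-cong-≗ (λ z → cong (f z *_) (sum-cong-≗ (λ w →
             cong₂ (λ a b → g a * h b) ([w+z]-z≡w w z) (x-[w+z]≡x-z-w x w z)))) ⟩
      Σ (λ z → f z * Σ (λ w → g w * h ((x -ₙ z) -ₙ w)))  ∎
    where open ≡-Reasoning

  δ⋆ : ∀ c g x → (δ c ⋆ g) x ≡ g (x -ₙ c)
  δ⋆ c g x = Σ-δ c (λ y → g (x -ₙ y))

  δ0⋆ : ∀ g x → (δ 0ₙ ⋆ g) x ≡ g x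
  δ0⋆ g x = trans (δ⋆ 0ₙ g x) (cong g (x-0≡x x))

  δ⋆δ : ∀ a b x → (δ a ⋆ δ b) x ≡ δ (a +ₙ b) x
  δ⋆δ a b x = trans (δ⋆ a (δ b) x)
    (𝟙-⇔ ((x -ₙ a) FP.≟ b) (x FP.≟ (a +ₙ b))
         (λ { refl → sym (a+[x-a]≡x a x) }) (λ { refl → [a+b]-a≡b a b }))

  ⋆-distribʳ : ∀ f g h x → ((λ y → f y + g y) ⋆ h) x ≡ (f ⋆ h) x + (g ⋆ h) x
  ⋆-distribʳ f g h x = trans (sum-cong-≗ (λ y → ℕP.*-distribʳ-+ (h (x -ₙ y)) (f y) (g y)))
                             (∑-distrib-+ (λ y → f y * h (x -ₙ y)) (λ y → g y * h (x -ₙ y)))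

  ⋆-zeroˡ : ∀ g x → ((λ _ → 0) ⋆ g) x ≡ 0
  ⋆-zeroˡ g x = sum-replicate-zero n

  ⋆-const : ∀ f c x → (f ⋆ (λ _ → c)) x ≡ Σ f * c
  ⋆-const f c x = sym (*-distribʳ-sum c f)

  Σ⋆ : ∀ f g → Σ (f ⋆ g) ≡ Σ f * Σ g
  Σ⋆ f g = begin
      Σ (λ x → Σ (λ y → f y * g (x -ₙ y)))  ≡⟨ ∑-comm (λ x y → f y * g (x -ₙ y)) ⟩
      Σ (λ y → Σ (λ x → f y * g (x -ₙ y)))  ≡⟨ sum-cong-≗ (λ y → *-distribˡ-sum (f y) (λ x → g (x -ₙ y))) ⟨
      Σ (λ y → f y * Σ (λ x → g (x -ₙ y)))  ≡⟨ sum-cong-≗ (λ y → cong (f y *_) (Σ-translate⁻ y g)) ⟨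
      Σ (λ y → f y * Σ g)                   ≡⟨ *-distribʳ-sum (Σ g) f ⟨
      Σ f * Σ g                             ∎
    where open ≡-Reasoning

module PrimeFacts where

  open import Data.Nat using (zero; suc; _+_; _*_; _^_; _<_)
  import Data.Nat.Properties as ℕP
  open import Data.Nat.Combinatorics using (_C_; nC1≡n; nCk+nC[k+1]≡[n+1]C[k+1])
  open import Data.Nat.Divisibility using (_∣_; divides; ∣⇒≤; ∣1⇒≡1)
  open import Data.Nat.Primality using (Prime; euclidsLemma; ¬prime[0]; ¬prime[1])
  open import Data.Nat.Tactic.RingSolver using (solve-∀)
  open import Data.Sum using (inj₁; inj₂)
  open import Data.Product using (∃; _,_)
  open import Data.Empty using (⊥-elim)
  open import Relation.Binary.PropositionalEquality

  absorption : ∀ n k → suc k * (suc n C suc k) ≡ suc n * (n C k)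
  absorption zero zero = refl
  absorption zero (suc k) = trans (ℕP.*-zeroʳ (suc (suc k))) (sym (ℕP.*-zeroʳ 1))
  absorption (suc n) zero = trans (ℕP.*-identityˡ _) (trans (nC1≡n (suc (suc n))) (sym (ℕP.*-identityʳ _)))
  absorption (suc n) (suc k) = begin
      suc (suc k) * (suc (suc n) C suc (suc k))
        ≡⟨ cong (suc (suc k) *_) (nCk+nC[k+1]≡[n+1]C[k+1] (suc n) (suc k)) ⟨
      suc (suc k) * (a + b)               ≡⟨ expand k a b ⟩
      a + (suc k * a + suc (suc k) * b)   ≡⟨ cong₂ (λ x y → a + (x + y)) (absorption n k) (absorption n (suc k)) ⟩
      a + (suc n * c + suc n * d)         ≡⟨ cong (a +_) (ℕP.*-distribˡ-+ (suc n) c d) ⟨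
      a + suc n * (c + d)                 ≡⟨ cong (λ x → a + suc n * x) (nCk+nC[k+1]≡[n+1]C[k+1] n k) ⟩
      a + suc n * a                       ∎
    where
    open ≡-Reasoning
    a b c d : ℕ
    a = suc n C suc k
    b = suc n C suc (suc k)
    c = n C k
    d = n C suc k
    expand : ∀ k a b → suc (suc k) * (a + b) ≡ a + (suc k * a + suc (suc k) * b)
    expand = solve-∀

  -- from q · C(q-1, k-1) = k · C(q, k) and q ∤ k
  prime∣C : ∀ {q} → Prime q → ∀ k → 0 < k → k < q → q ∣ q C k
  prime∣C {suc n} q-prime (suc k) _ k<q
    with euclidsLemma (suc k) (suc n C suc k) q-prime
           (divides (n C k) (trans (absorption n k) (ℕP.*-comm (suc n) (n C k))))
  ... | inj₂ q∣C = q∣C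
  ... | inj₁ q∣k+1 = ⊥-elim (ℕP.<⇒≱ k<q (∣⇒≤ q∣k+1))

  prime⇒2+ : ∀ {q} → Prime q → ∃ λ m → suc (suc m) ≡ q
  prime⇒2+ {zero} q-prime = ⊥-elim (¬prime[0] q-prime)
  prime⇒2+ {suc zero} q-prime = ⊥-elim (¬prime[1] q-prime)
  prime⇒2+ {suc (suc m)} _ = m , refl

  prime∣^ : ∀ {q} → Prime q → ∀ a k → q ∣ a ^ k → q ∣ a
  prime∣^ q-prime a zero q∣1 = ⊥-elim (¬prime[1] (subst Prime (∣1⇒≡1 q∣1) q-prime))
  prime∣^ q-prime a (suc k) q∣a^k+1 with euclidsLemma a (a ^ k) q-prime q∣a^k+1
  ... | inj₁ q∣a = q∣a
  ... | inj₂ q∣a^k = prime∣^ q-prime a k q∣a^k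

module Residues (q : ℕ) .{{_ : NonZero q}} where

  open import Data.Nat using (zero; suc; _+_; _*_)
  open import Data.Nat.DivMod using (_%_; %-distribˡ-+; %-distribˡ-*)
  open import Data.Nat.Divisibility using (_∣_; _∣0; ∣m∣n⇒∣m+n)
  open import Data.Fin using (Fin)
  open import Relation.Binary.PropositionalEquality
  open FiniteSums

  %-+ : ∀ {a a' b b'} → a % q ≡ a' % q → b % q ≡ b' % q → (a + b) % q ≡ (a' + b') % q
  %-+ {a} {a'} {b} {b'} e₁ e₂ =
    trans (%-distribˡ-+ a b q) (trans (cong₂ (λ x y → (x + y) % q) e₁ e₂) (sym (%-distribˡ-+ a' b' q)))

  %-* : ∀ {a a' b b'} → a % q ≡ a' % q → b % q ≡ b' % q → (a * b) % q ≡ (a' * b') % q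
  %-* {a} {a'} {b} {b'} e₁ e₂ =
    trans (%-distribˡ-* a b q) (trans (cong₂ (λ x y → (x * y) % q) e₁ e₂) (sym (%-distribˡ-* a' b' q)))

  Σ-% : ∀ {k} {f g : Fin k → ℕ} → (∀ i → f i % q ≡ g i % q) → Σ f % q ≡ Σ g % q
  Σ-% {zero} _ = refl
  Σ-% {suc k} e = %-+ (e Fin.zero) (Σ-% (λ i → e (Fin.suc i)))

  Σ-∣ : ∀ {k} (f : Fin k → ℕ) → (∀ i → q ∣ f i) → q ∣ Σ f
  Σ-∣ {zero} f _ = q ∣0
  Σ-∣ {suc k} f q∣f = ∣m∣n⇒∣m+n (q∣f Fin.zero) (Σ-∣ (λ i → f (Fin.suc i)) (λ i → q∣f (Fin.suc i)))

-- The group semiring ℕ[ℤ_n] modulo q: equality is taken pointwise modulo q.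
-- It is a commutative semiring, so powers and the binomial theorem from the
-- algebra library apply to it.
module GroupSemiringMod (n : ℕ) .{{_ : NonZero n}} (q : ℕ) .{{_ : NonZero q}} where

  open import Level using (0ℓ)
  open import Data.Nat using (_+_)
  import Data.Nat.Properties as ℕP
  open import Data.Nat.DivMod using (_%_)
  open import Relation.Binary.PropositionalEquality
  open import Relation.Binary.Structures using (IsEquivalence)
  open import Algebra.Bundles using (CommutativeSemiring)
  open import Defs
  open CyclicGroup n
  open GroupSemiring n
  open Residues q

  infix 4 _≈q_
  _≈q_ : Fn → Fn → Set
  f ≈q g = ∀ x → f x % q ≡ g x % q

  ≈q-reflexive : ∀ {f g} → (∀ x → f x ≡ g x) → f ≈q g
  ≈q-reflexive f≗g x = cong (_% q) (f≗g x)

  infixl 6 _⊕_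
  _⊕_ : Fn → Fn → Fn
  (f ⊕ g) x = f x + g x

  0̂ : Fn
  0̂ _ = 0

  ≈q-isEquivalence : IsEquivalence _≈q_
  ≈q-isEquivalence = record
    { refl = λ _ → refl ; sym = λ e x → sym (e x) ; trans = λ e₁ e₂ x → trans (e₁ x) (e₂ x) }

  ⊕-cong : ∀ {f f' g g'} → f ≈q f' → g ≈q g' → f ⊕ g ≈q f' ⊕ g'
  ⊕-cong e₁ e₂ x = %-+ (e₁ x) (e₂ x)

  ⋆-cong : ∀ {f f' g g'} → f ≈q f' → g ≈q g' → f ⋆ g ≈q f' ⋆ g'
  ⋆-cong e₁ e₂ x = Σ-% (λ y → %-* (e₁ y) (e₂ (x -ₙ y)))

  open import Algebra.Structures _≈q_ using (IsCommutativeMonoid)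
  open import Algebra.Structures.Biased _≈q_ using (isCommutativeMonoidˡ; isCommutativeSemiringˡ)

  ⊕-isCommutativeMonoid : IsCommutativeMonoid _⊕_ 0̂
  ⊕-isCommutativeMonoid = isCommutativeMonoidˡ record
    { isSemigroup = record
        { isMagma = record { isEquivalence = ≈q-isEquivalence ; ∙-cong = ⊕-cong }
        ; assoc = λ f g h → ≈q-reflexive (λ x → ℕP.+-assoc (f x) (g x) (h x)) }
    ; identityˡ = λ f _ → refl
    ; comm = λ f g → ≈q-reflexive (λ x → ℕP.+-comm (f x) (g x)) }

  ⋆-isCommutativeMonoid : IsCommutativeMonoid _⋆_ (δ 0ₙ)
  ⋆-isCommutativeMonoid = isCommutativeMonoidˡ record
    { isSemigroup = record
        { isMagma = record { isEquivalence = ≈q-isEquivalence ; ∙-cong = ⋆-cong }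
        ; assoc = λ f g h → ≈q-reflexive (⋆-assoc f g h) }
    ; identityˡ = λ f → ≈q-reflexive (δ0⋆ f)
    ; comm = λ f g → ≈q-reflexive (⋆-comm f g) }

  ℕ[ℤn]/q : CommutativeSemiring 0ℓ 0ℓ
  ℕ[ℤn]/q = record
    { Carrier = Fn ; _≈_ = _≈q_ ; _+_ = _⊕_ ; _*_ = _⋆_ ; 0# = 0̂ ; 1# = δ 0ₙ
    ; isCommutativeSemiring = isCommutativeSemiringˡ record
        { +-isCommutativeMonoid = ⊕-isCommutativeMonoid
        ; *-isCommutativeMonoid = ⋆-isCommutativeMonoid
        ; distribʳ = λ h f g → ≈q-reflexive (⋆-distribʳ f g h)
        ; zeroˡ = λ g → ≈q-reflexive (⋆-zeroˡ g) } }

-- The Frobenius identity in ℕ[ℤ_n]/q for a prime q: (f + g)^q ≡ f^q + g^q,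
-- since q divides every inner binomial coefficient.  Together with
-- δ_c^k = δ_{k·c} this turns the q-th power of a sum of point masses into
-- the sum of the point masses dilated by q.
module Frobenius (n : ℕ) .{{_ : NonZero n}} (q : ℕ) (q-prime : Prime q) where

  open import Data.Nat using (zero; suc; _+_; _*_; _∸_; _<_; z≤n; s≤s)
  import Data.Nat.Properties as ℕP
  open import Data.Nat.DivMod using (_%_; %-remove-+ʳ)
  open import Data.Nat.Divisibility using (_∣_; ∣-trans; m∣m*n)
  open import Data.Nat.Combinatorics using (_C_; nCn≡1)
  open import Data.Nat.Primality using (prime⇒nonZero)
  open import Data.Fin as Fin using (Fin; toℕ)
  import Data.Fin.Properties as FP
  open import Data.Product using (_,_)
  open import Relation.Binary.PropositionalEquality
  open import Algebra.Bundles using (CommutativeSemiring)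
  open import Defs
  open CyclicGroup n
  open FiniteSums
  open GroupSemiring n
  open PrimeFacts
  open ≡-Reasoning

  instance
    q≢0 : NonZero q
    q≢0 = prime⇒nonZero q-prime

  open GroupSemiringMod n q
  open Residues q
  open CommutativeSemiring ℕ[ℤn]/q using (semiring)
  open import Algebra.Properties.Semiring.Exp semiring public using (_^_; ^-congˡ)
  open import Algebra.Properties.Semiring.Mult semiring using (_×_)
  open import Algebra.Properties.Semiring.Sum semiring public using () renaming (sum to ⨁)
  import Algebra.Properties.CommutativeSemiring.Binomial ℕ[ℤn]/q as Binomial

  ⨁-at : ∀ {m} (t : Fin m → Fn) x → ⨁ t x ≡ Σ (λ i → t i x)
  ⨁-at {zero} t x = refl
  ⨁-at {suc m} t x = cong (t Fin.zero x +_) (⨁-at (λ i → t (Fin.suc i)) x)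

  ×-at : ∀ c f x → (c × f) x ≡ c * f x
  ×-at zero f x = refl
  ×-at (suc c) f x = cong (f x +_) (×-at c f x)

  binomialTermAt : ∀ f g x → Fin (suc q) → ℕ
  binomialTermAt f g x k = (q C toℕ k) * (f ^ toℕ k ⋆ g ^ (q ∸ toℕ k)) x

  binomialExpansion-at : ∀ f g x → Binomial.binomialExpansion f g q x ≡ Σ (binomialTermAt f g x)
  binomialExpansion-at f g x =
    trans (⨁-at (Binomial.binomialTerm f g q) x) (sum-cong-≗ (λ k → ×-at (q C toℕ k) (Binomial.binomial f g q k) x))

  -- Modulo q only the two extreme terms survive.  Stated for q = 2 + m so
  -- that the first, middle and last terms can be separated.
  extremeTerms : ∀ m → suc (suc m) ≡ q → ∀ f g x →
                 Σ (binomialTermAt f g x) % q ≡ (f ^ q ⊕ g ^ q) x % q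
  extremeTerms m refl f g x = begin
      Σ T % q                                   ≡⟨ cong (λ s → (T Fin.zero + s) % q) (sum-init-last (λ i → T (Fin.suc i))) ⟩
      (T Fin.zero + (Σ middle + T last)) % q    ≡⟨ cong₂ (λ a b → (a + (Σ middle + b)) % q) first≡ last≡ ⟩
      (G + (Σ middle + F)) % q                  ≡⟨ cong (_% q) (regroup G (Σ middle) F) ⟩
      (F + G + Σ middle) % q                    ≡⟨ %-remove-+ʳ (F + G) (Σ-∣ middle q∣middle) ⟩
      (F + G) % q                               ∎
    where
    T : Fin (suc q) → ℕ
    T = binomialTermAt f g x
    F G : ℕ
    F = (f ^ q) x
    G = (g ^ q) x
    last : Fin (suc q)
    last = Fin.suc (Fin.fromℕ (suc m))
    middle : Fin (suc m) → ℕ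
    middle j = T (Fin.suc (Fin.inject₁ j))
    regroup : ∀ a b c → a + (b + c) ≡ c + a + b
    regroup a b c = trans (cong (a +_) (ℕP.+-comm b c)) (trans (sym (ℕP.+-assoc a c b)) (cong (_+ b) (ℕP.+-comm a c)))
    first≡ : T Fin.zero ≡ G
    first≡ = trans (ℕP.*-identityˡ _) (δ0⋆ (g ^ q) x)
    last≡ : T last ≡ F
    last≡ = begin
      (q C toℕ last) * (f ^ toℕ last ⋆ g ^ (q ∸ toℕ last)) x
        ≡⟨ cong (λ k → (q C k) * (f ^ k ⋆ g ^ (q ∸ k)) x) (cong suc (FP.toℕ-fromℕ (suc m))) ⟩
      (q C q) * (f ^ q ⋆ g ^ (q ∸ q)) x   ≡⟨ cong₂ (λ a b → a * (f ^ q ⋆ g ^ b) x) (nCn≡1 q) (ℕP.n∸n≡0 q) ⟩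
      1 * (f ^ q ⋆ δ 0ₙ) x                ≡⟨ ℕP.*-identityˡ _ ⟩
      (f ^ q ⋆ δ 0ₙ) x                    ≡⟨ ⋆-comm (f ^ q) (δ 0ₙ) x ⟩
      (δ 0ₙ ⋆ f ^ q) x                    ≡⟨ δ0⋆ (f ^ q) x ⟩
      F                                   ∎
    q∣middle : ∀ j → q ∣ middle j
    q∣middle j = ∣-trans (prime∣C q-prime (suc (toℕ (Fin.inject₁ j))) (s≤s z≤n)
                                 (s≤s (subst (_< suc m) (sym (FP.toℕ-inject₁ j)) (FP.toℕ<n j))))
                         (m∣m*n _)

  frobenius : ∀ f g → (f ⊕ g) ^ q ≈q f ^ q ⊕ g ^ q
  frobenius f g x with prime⇒2+ q-prime
  ... | m , 2+m≡q = begin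
      ((f ⊕ g) ^ q) x % q                          ≡⟨ Binomial.theorem q f g x ⟩
      Binomial.binomialExpansion f g q x % q       ≡⟨ cong (_% q) (binomialExpansion-at f g x) ⟩
      Σ (binomialTermAt f g x) % q                 ≡⟨ extremeTerms m 2+m≡q f g x ⟩
      (f ^ q ⊕ g ^ q) x % q                        ∎

  0̂^q≡0̂ : ∀ x → (0̂ ^ q) x ≡ 0
  0̂^q≡0̂ x with prime⇒2+ q-prime
  ... | m , refl = ⋆-zeroˡ (0̂ ^ suc m) x

  frobenius-⨁ : ∀ {k} (t : Fin k → Fn) → ⨁ t ^ q ≈q ⨁ (λ i → t i ^ q)
  frobenius-⨁ {zero} t x = cong (_% q) (0̂^q≡0̂ x)
  frobenius-⨁ {suc k} t x =
    trans (frobenius (t Fin.zero) (⨁ (λ i → t (Fin.suc i))) x)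
          (⊕-cong {f = t Fin.zero ^ q} (λ _ → refl) (frobenius-⨁ (λ i → t (Fin.suc i))) x)

  δ^k≡δ[k·c] : ∀ k c x → (δ c ^ k) x ≡ δ (k ·ₙ c) x
  δ^k≡δ[k·c] zero c x = cong (λ a → δ a x) (sym (0·a≡0 c))
  δ^k≡δ[k·c] (suc k) c x = begin
      (δ c ⋆ δ c ^ k) x        ≡⟨ sum-cong-≗ (λ y → cong (δ c y *_) (δ^k≡δ[k·c] k c (x -ₙ y))) ⟩
      (δ c ⋆ δ (k ·ₙ c)) x     ≡⟨ δ⋆δ c (k ·ₙ c) x ⟩
      δ (c +ₙ (k ·ₙ c)) x      ≡⟨ cong (λ a → δ a x) ([1+k]·a≡a+k·a k c) ⟨
      δ (suc k ·ₙ c) x         ∎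

module Subsets where

  open import Data.Nat using (suc; _≤_)
  import Data.Nat.Properties as ℕP
  open import Data.Bool using (true; false)
  open import Data.Vec using ([]; _∷_; tabulate)
  import Data.Vec.Properties as VP
  open import Data.Fin using (Fin)
  import Data.Fin.Properties as FP
  open import Data.Fin.Subset using (_∈_; ∣_∣)
  open import Data.Fin.Subset.Properties using (_∈?_)
  open import Data.Product using (∃; _,_)
  open import Relation.Nullary using (Dec; yes; no; does)
  open import Level using (0ℓ)
  open import Relation.Unary using (Pred; Decidable)
  open import Relation.Binary.PropositionalEquality
  open import Data.Empty using (⊥-elim)
  open FiniteSums

  ⟦_⟧ : ∀ {n} {P : Pred (Fin n) 0ℓ} → Decidable P → Subset n
  ⟦ P? ⟧ = tabulate (λ x → does (P? x))

  ∈⟦⟧⇒ : ∀ {n} {P : Pred (Fin n) 0ℓ} (P? : Decidable P) {x} → x ∈ ⟦ P? ⟧ → P x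
  ∈⟦⟧⇒ P? {x} x∈ with P? x | trans (sym (VP.lookup∘tabulate (λ y → does (P? y)) x)) (VP.[]=⇒lookup x∈)
  ... | yes Px | _ = Px
  ... | no _ | ()

  ⇒∈⟦⟧ : ∀ {n} {P : Pred (Fin n) 0ℓ} (P? : Decidable P) {x} → P x → x ∈ ⟦ P? ⟧
  ⇒∈⟦⟧ {P = P} P? {x} Px = VP.lookup⇒[]= x ⟦ P? ⟧ (trans (VP.lookup∘tabulate (λ y → does (P? y)) x) (does-yes (P? x)))
    where
    does-yes : (d : Dec (P x)) → does d ≡ true
    does-yes (yes _) = refl
    does-yes (no ¬Px) = ⊥-elim (¬Px Px)

  χ : ∀ {n} → Subset n → Fin n → ℕ
  χ S a = 𝟙 (a ∈? S)

  χ∈ : ∀ {n} {S : Subset n} {a} → a ∈ S → χ S a ≡ 1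
  χ∈ {S = S} {a} = 𝟙-yes (a ∈? S)

  χ-pos : ∀ {n} {S : Subset n} {a} → 1 ≤ χ S a → a ∈ S
  χ-pos {S = S} {a} = 𝟙-pos (a ∈? S)

  χ≤1 : ∀ {n} (S : Subset n) a → χ S a ≤ 1
  χ≤1 S a = 𝟙≤1 (a ∈? S)

  ∣S∣≡Σχ : ∀ {n} (S : Subset n) → ∣ S ∣ ≡ Σ (χ S)
  ∣S∣≡Σχ [] = refl
  ∣S∣≡Σχ (true ∷ S) = cong suc (∣S∣≡Σχ S)
  ∣S∣≡Σχ (false ∷ S) = ∣S∣≡Σχ S

  injection-onto : ∀ {n k} (S : Subset n) (f : Fin k → Fin n) → (∀ i → f i ∈ S) →
                   (∀ i j → f i ≡ f j → i ≡ j) → ∣ S ∣ ≡ k → ∀ {x} → x ∈ S → ∃ λ i → f i ≡ x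
  injection-onto {n} {k} S f f∈S f-inj ∣S∣≡k {x} x∈S
    with Σ-pos (preimages x) (ℕP.≤-reflexive (trans (sym (χ∈ x∈S)) (sym (preimages≡χ x))))
    where
    preimages : Fin n → Fin k → ℕ
    preimages y i = 𝟙 (y FP.≟ f i)
    preimages≤χ : ∀ y → Σ (preimages y) ≤ χ S y
    preimages≤χ y = ≤1⇒≤ (Σ≤1 (preimages y) (λ i → 𝟙≤1 (y FP.≟ f i)) at-most-one) y∈S
      where
      at-most-one : ∀ i j → 1 ≤ preimages y i → 1 ≤ preimages y j → i ≡ j
      at-most-one i j pos pos′ = f-inj i j (trans (sym (𝟙-pos (y FP.≟ f i) pos)) (𝟙-pos (y FP.≟ f j) pos′))
      y∈S : 1 ≤ Σ (preimages y) → 1 ≤ χ S y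
      y∈S pos with Σ-pos (preimages y) pos
      ... | i , pos′ = ℕP.≤-reflexive (sym (χ∈ (subst (_∈ S) (sym (𝟙-pos (y FP.≟ f i) pos′)) (f∈S i))))
    Σpreimages : Σ (λ y → Σ (preimages y)) ≡ k
    Σpreimages = trans (∑-comm preimages) (trans (sum-cong-≗ (λ i → Σ-𝟙 (f i))) (Σ-1 k))
    preimages≡χ : ∀ y → Σ (preimages y) ≡ χ S y
    preimages≡χ = Σ-mono-tight (λ y → Σ (preimages y)) (χ S) preimages≤χ
                    (ℕP.≤-reflexive (trans (sym (∣S∣≡Σχ S)) (trans ∣S∣≡k (sym Σpreimages))))
  ... | i , pos = i , sym (𝟙-pos (x FP.≟ f i) pos)

-- The dilation lemma (Tijdeman's argument) shows that
-- replacing ψ by q·ψ for a prime q ∤ |A| preserves tiling; iterating over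
-- the prime factors gives the multiplier theorem.
module Tiling (n : ℕ) .{{_ : NonZero n}} (A B : Subset n) where

  open import Data.Nat as ℕ using (zero; suc; _+_; _*_; _≤_; z≤n; s≤s)
  import Data.Nat.Properties as ℕP
  open import Data.Nat.DivMod using (_%_; m*n%n≡0)
  open import Data.Nat.Divisibility using (_∣_; ∣-trans; n∣m*n; m∣m*n; m%n≡0⇒n∣m)
  open import Data.Nat.Coprimality using (Coprime)
  open import Data.Nat.Primality using (Prime; ¬prime[1])
  open import Data.Nat.Primality.Factorisation using (PrimeFactorisation; factorise; module PrimeFactorisation)
  open import Data.Nat.ListAction using (product)
  open import Data.List using (List; []; _∷_)
  open import Data.List.Relation.Unary.All using (All; []; _∷_)
  open import Data.Fin using (Fin)
  import Data.Fin.Properties as FP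
  open import Data.Fin.Subset using (_∈_; ∣_∣)
  open import Data.Fin.Subset.Properties using (_∈?_)
  open import Data.Product using (∃; _×_; _,_)
  open import Data.Empty using (⊥-elim)
  open import Relation.Nullary using (¬_; yes; no)
  open import Relation.Binary.PropositionalEquality
  open import Defs
  open CyclicGroup n
  open FiniteSums
  open GroupSemiring n
  open Subsets
  open PrimeFacts

  reps : (Fin n → Fin n) → Fin n → ℕ
  reps ψ g = Σ (λ a → χ A a * χ B (g -ₙ ψ a))

  Tiles : (Fin n → Fin n) → Set
  Tiles ψ = ∀ g → reps ψ g ≡ 1

  mass : (Fin n → Fin n) → Fn
  mass ψ x = Σ (λ a → χ A a * δ (ψ a) x)

  mass⋆ : ∀ ψ h g → (mass ψ ⋆ h) g ≡ Σ (λ a → χ A a * h (g -ₙ ψ a))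
  mass⋆ ψ h g = begin
      Σ (λ y → Σ (λ a → χ A a * δ (ψ a) y) * h (g -ₙ y))
        ≡⟨ sum-cong-≗ (λ y → *-distribʳ-sum (h (g -ₙ y)) (λ a → χ A a * δ (ψ a) y)) ⟩
      Σ (λ y → Σ (λ a → χ A a * δ (ψ a) y * h (g -ₙ y)))
        ≡⟨ ∑-comm (λ y a → χ A a * δ (ψ a) y * h (g -ₙ y)) ⟩
      Σ (λ a → Σ (λ y → χ A a * δ (ψ a) y * h (g -ₙ y)))
        ≡⟨ sum-cong-≗ (λ a → sum-cong-≗ (λ y → ℕP.*-assoc (χ A a) (δ (ψ a) y) (h (g -ₙ y)))) ⟩
      Σ (λ a → Σ (λ y → χ A a * (δ (ψ a) y * h (g -ₙ y))))
        ≡⟨ sum-cong-≗ (λ a → *-distribˡ-sum (χ A a) (λ y → δ (ψ a) y * h (g -ₙ y))) ⟨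
      Σ (λ a → χ A a * Σ (λ y → δ (ψ a) y * h (g -ₙ y)))
        ≡⟨ sum-cong-≗ (λ a → cong (χ A a *_) (Σ-δ (ψ a) (λ y → h (g -ₙ y)))) ⟩
      Σ (λ a → χ A a * h (g -ₙ ψ a))  ∎
    where open ≡-Reasoning

  Σ-mass : ∀ ψ → Σ (mass ψ) ≡ ∣ A ∣
  Σ-mass ψ = begin
      Σ (λ x → Σ (λ a → χ A a * δ (ψ a) x))  ≡⟨ ∑-comm (λ x a → χ A a * δ (ψ a) x) ⟩
      Σ (λ a → Σ (λ x → χ A a * δ (ψ a) x))  ≡⟨ sum-cong-≗ (λ a → *-distribˡ-sum (χ A a) (δ (ψ a))) ⟨
      Σ (λ a → χ A a * Σ (δ (ψ a)))          ≡⟨ sum-cong-≗ (λ a → trans (cong (χ A a *_) (Σ-𝟙 (ψ a))) (ℕP.*-identityʳ (χ A a))) ⟩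
      Σ (χ A)                                ≡⟨ ∣S∣≡Σχ A ⟨
      ∣ A ∣                                  ∎
    where open ≡-Reasoning

  Σ-reps : ∀ ψ → Σ (reps ψ) ≡ ∣ A ∣ * ∣ B ∣
  Σ-reps ψ = begin
      Σ (λ g → Σ (λ a → χ A a * χ B (g -ₙ ψ a)))  ≡⟨ ∑-comm (λ g a → χ A a * χ B (g -ₙ ψ a)) ⟩
      Σ (λ a → Σ (λ g → χ A a * χ B (g -ₙ ψ a)))  ≡⟨ sum-cong-≗ (λ a → *-distribˡ-sum (χ A a) (λ g → χ B (g -ₙ ψ a))) ⟨
      Σ (λ a → χ A a * Σ (λ g → χ B (g -ₙ ψ a)))  ≡⟨ sum-cong-≗ (λ a → cong (χ A a *_) (Σ-translate⁻ (ψ a) (χ B))) ⟨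
      Σ (λ a → χ A a * Σ (χ B))                   ≡⟨ *-distribʳ-sum (Σ (χ B)) (χ A) ⟨
      Σ (χ A) * Σ (χ B)                           ≡⟨ cong₂ _*_ (∣S∣≡Σχ A) (∣S∣≡Σχ B) ⟨
      ∣ A ∣ * ∣ B ∣                               ∎
    where open ≡-Reasoning

  tiles⇒∣A∣*∣B∣≡n : ∀ ψ → Tiles ψ → ∣ A ∣ * ∣ B ∣ ≡ n
  tiles⇒∣A∣*∣B∣≡n ψ tiles = trans (sym (Σ-reps ψ)) (trans (sum-cong-≗ tiles) (Σ-1 n))

  tiling-unique : ∀ ψ → Tiles ψ → ∀ {a a'} g → a ∈ A → a' ∈ A →
                  (g -ₙ ψ a) ∈ B → (g -ₙ ψ a') ∈ B → a ≡ a'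
  tiling-unique ψ tiles {a} {a'} g a∈A a'∈A b∈B b'∈B with a FP.≟ a'
  ... | yes a≡a' = a≡a'
  ... | no a≢a' = ⊥-elim (two≰one (subst (2 ≤_) (tiles g)
                    (Σ≥2 (λ x → χ A x * χ B (g -ₙ ψ x)) a a' a≢a' (positive a∈A b∈B) (positive a'∈A b'∈B))))
    where
    two≰one : ¬ 2 ≤ 1
    two≰one (s≤s ())
    positive : ∀ {a} → a ∈ A → (g -ₙ ψ a) ∈ B → 1 ≤ χ A a * χ B (g -ₙ ψ a)
    positive a∈A b∈B = ℕP.≤-reflexive (sym (cong₂ _*_ (χ∈ a∈A) (χ∈ b∈B)))

  tiling-exists : ∀ ψ → Tiles ψ → ∀ g → ∃ λ a → a ∈ A × (g -ₙ ψ a) ∈ B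
  tiling-exists ψ tiles g with Σ-pos (λ a → χ A a * χ B (g -ₙ ψ a)) (ℕP.≤-reflexive (sym (tiles g)))
  ... | a , 1≤χχ with *-pos {χ A a} 1≤χχ
  ...   | 1≤χa , 1≤χb = a , χ-pos 1≤χa , χ-pos 1≤χb

  -- With γ = mass ψ we have γ ⋆ χ_B ≡ 1, hence γ^q ⋆ χ_B ≡ |A|^(q-1),
  -- while by Frobenius γ^q ≡ mass (q·ψ) modulo q; so every g has a number of
  -- representations under q·ψ that is ≢ 0 (mod q), hence ≥ 1, and since
  -- there are n representations in total each g has exactly one.
  module Dilation (q : ℕ) (q-prime : Prime q) (q∤∣A∣ : ¬ q ∣ ∣ A ∣) (ψ : Fin n → Fin n) (tiles : Tiles ψ) where

    open Frobenius n q q-prime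
    open GroupSemiringMod n q using (_≈q_; 0̂; ⋆-cong)

    γ : Fn
    γ = mass ψ

    Σγ^k : ∀ k → Σ (γ ^ k) ≡ ∣ A ∣ ℕ.^ k
    Σγ^k zero = Σ-𝟙 0ₙ
    Σγ^k (suc k) = trans (Σ⋆ γ (γ ^ k)) (cong₂ _*_ (Σ-mass ψ) (Σγ^k k))

    γ^[1+k]⋆B : ∀ k g → (γ ^ suc k ⋆ χ B) g ≡ ∣ A ∣ ℕ.^ k
    γ^[1+k]⋆B k g = begin
        ((γ ⋆ γ ^ k) ⋆ χ B) g    ≡⟨ sum-cong-≗ (λ y → cong (_* χ B (g -ₙ y)) (⋆-comm γ (γ ^ k) y)) ⟩
        ((γ ^ k ⋆ γ) ⋆ χ B) g    ≡⟨ ⋆-assoc (γ ^ k) γ (χ B) g ⟩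
        (γ ^ k ⋆ (γ ⋆ χ B)) g    ≡⟨ sum-cong-≗ (λ y → cong ((γ ^ k) y *_) (trans (mass⋆ ψ (χ B) (g -ₙ y)) (tiles (g -ₙ y)))) ⟩
        (γ ^ k ⋆ (λ _ → 1)) g    ≡⟨ ⋆-const (γ ^ k) 1 g ⟩
        Σ (γ ^ k) * 1            ≡⟨ ℕP.*-identityʳ _ ⟩
        Σ (γ ^ k)                ≡⟨ Σγ^k k ⟩
        ∣ A ∣ ℕ.^ k              ∎
      where open ≡-Reasoning

    -- mass φ as a finite sum in the semiring, so that Frobenius applies
    pointMass : (Fin n → Fin n) → Fin n → Fn
    pointMass φ a with a ∈? A
    ... | yes _ = δ (φ a)
    ... | no _ = 0̂

    pointMass-at : ∀ φ a x → pointMass φ a x ≡ χ A a * δ (φ a) x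
    pointMass-at φ a x with a ∈? A
    ... | yes _ = sym (ℕP.+-identityʳ _)
    ... | no _ = refl

    pointMass^q : ∀ a x → (pointMass ψ a ^ q) x ≡ χ A a * δ (q ·ₙ ψ a) x
    pointMass^q a x with a ∈? A
    ... | yes _ = trans (δ^k≡δ[k·c] q (ψ a) x) (sym (ℕP.+-identityʳ _))
    ... | no _ = 0̂^q≡0̂ x

    γ^q≈mass[qψ] : γ ^ q ≈q mass (λ a → q ·ₙ ψ a)
    γ^q≈mass[qψ] x = begin
        (γ ^ q) x % q                         ≡⟨ ^-congˡ q {γ} {⨁ (pointMass ψ)} γ≈⨁ x ⟩
        (⨁ (pointMass ψ) ^ q) x % q           ≡⟨ frobenius-⨁ (pointMass ψ) x ⟩
        ⨁ (λ a → pointMass ψ a ^ q) x % q     ≡⟨ cong (_% q) (trans (⨁-at (λ a → pointMass ψ a ^ q) x) (sum-cong-≗ (λ a → pointMass^q a x))) ⟩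
        mass (λ a → q ·ₙ ψ a) x % q           ∎
      where
      open ≡-Reasoning
      γ≈⨁ : γ ≈q ⨁ (pointMass ψ)
      γ≈⨁ y = cong (_% q) (sym (trans (⨁-at (pointMass ψ) y) (sum-cong-≗ (λ a → pointMass-at ψ a y))))

    reps[qψ]%q : ∀ k → suc (suc k) ≡ q → ∀ g → reps (λ a → q ·ₙ ψ a) g % q ≡ (∣ A ∣ ℕ.^ suc k) % q
    reps[qψ]%q k refl g = begin
        reps (λ a → q ·ₙ ψ a) g % q            ≡⟨ cong (_% q) (mass⋆ (λ a → q ·ₙ ψ a) (χ B) g) ⟨
        (mass (λ a → q ·ₙ ψ a) ⋆ χ B) g % q    ≡⟨ ⋆-cong {γ ^ q} {mass (λ a → q ·ₙ ψ a)} {χ B} {χ B} γ^q≈mass[qψ] (λ _ → refl) g ⟨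
        (γ ^ q ⋆ χ B) g % q                    ≡⟨ cong (_% q) (γ^[1+k]⋆B (suc k) g) ⟩
        (∣ A ∣ ℕ.^ suc k) % q                  ∎
      where open ≡-Reasoning

    reps[qψ]≥1 : ∀ g → 1 ≤ reps (λ a → q ·ₙ ψ a) g
    reps[qψ]≥1 g with prime⇒2+ q-prime | reps (λ a → q ·ₙ ψ a) g in eq
    ... | _ | suc _ = s≤s z≤n
    ... | k , 2+k≡q | zero = ⊥-elim (q∤∣A∣ (prime∣^ q-prime ∣ A ∣ (suc k)
          (m%n≡0⇒n∣m _ q (trans (sym (reps[qψ]%q k 2+k≡q g)) (trans (cong (_% q) eq) (m*n%n≡0 0 q))))))

    -- n representations in total, at least one for each of the n points
    dilation : Tiles (λ a → q ·ₙ ψ a)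
    dilation g = sym (Σ-mono-tight (λ _ → 1) (reps (λ a → q ·ₙ ψ a)) reps[qψ]≥1
                   (ℕP.≤-reflexive (trans (Σ-reps (λ a → q ·ₙ ψ a)) (trans (tiles⇒∣A∣*∣B∣≡n ψ tiles) (sym (Σ-1 n))))) g)

  -- Multiplier theorem: if ψ tiles and t is coprime to |A|, then t·ψ tiles.
  -- Factor t into primes and dilate by one prime at a time.
  dilate-by-product : ∀ ψ → Tiles ψ → (L : List ℕ) → All Prime L → Coprime (product L) ∣ A ∣ →
                      Tiles (λ a → product L ·ₙ ψ a)
  dilate-by-product ψ tiles [] _ _ g =
    trans (sum-cong-≗ (λ a → cong (λ z → χ A a * χ B (g -ₙ z)) (1·a≡a (ψ a)))) (tiles g)
  dilate-by-product ψ tiles (q ∷ L) (q-prime ∷ L-prime) coprime g =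
    trans (sum-cong-≗ (λ a → cong (λ z → χ A a * χ B (g -ₙ z)) (sym (q·[t·a]≡[q*t]·a q (product L) (ψ a)))))
          (Dilation.dilation q q-prime q∤∣A∣ (λ a → product L ·ₙ ψ a) tiles[Lψ] g)
    where
    tiles[Lψ] : Tiles (λ a → product L ·ₙ ψ a)
    tiles[Lψ] = dilate-by-product ψ tiles L L-prime (λ (i∣L , i∣A) → coprime (∣-trans i∣L (n∣m*n q) , i∣A))
    q∤∣A∣ : ¬ q ∣ ∣ A ∣
    q∤∣A∣ q∣A = ¬prime[1] (subst Prime (coprime (m∣m*n (product L) , q∣A)) q-prime)

  multiplier : ∀ ψ → Tiles ψ → ∀ t .{{_ : NonZero t}} → Coprime t ∣ A ∣ → Tiles (λ a → t ·ₙ ψ a)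
  multiplier ψ tiles t coprime =
    subst (λ s → Tiles (λ a → s ·ₙ ψ a)) (sym t≡∏)
          (dilate-by-product ψ tiles (factors fac) (factorsPrime fac) (subst (λ s → Coprime s ∣ A ∣) t≡∏ coprime))
    where
    open PrimeFactorisation
    fac : PrimeFactorisation t
    fac = factorise t
    t≡∏ : t ≡ product (factors fac)
    t≡∏ = isFactorisation fac

module SolvingCongruences where

  open import Data.Nat as ℕ using (zero; suc; _<_; _≤_)
  import Data.Nat.Properties as ℕP
  open import Data.Nat.Divisibility as ℕ∣ using () renaming (_∣_ to _∣ℕ_)
  open import Data.Nat.Primality using (Prime; euclidsLemma; prime⇒nonZero; prime⇒irreducible; prime⇒nonTrivial)
  open import Data.Nat.Coprimality using (Coprime; coprime-Bézout; coprime-divisor)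
  open import Data.Nat.GCD using (module Bézout)
  open import Data.Integer using (ℤ; +_; -[1+_]; _+_; _-_; _*_; -_) renaming (∣_∣ to abs)
  import Data.Integer.Properties as ℤP
  open import Data.Integer.Divisibility.Signed using (_∣_; divides; ∣ᵤ⇒∣; ∣⇒∣ᵤ; ∣m⇒∣m*n)
  open import Data.Integer.Tactic.RingSolver using (solve-∀)
  open import Data.Product using (∃; ∃₂; _×_; _,_; proj₁; proj₂)
  open import Data.Sum using (_⊎_; inj₁; inj₂; [_,_]′)
  open import Data.Empty using (⊥-elim)
  open import Relation.Nullary using (¬_; yes; no)
  open import Relation.Binary.PropositionalEquality
  open IntegerCongruence

  euclidℤ : ∀ {p} → Prime p → ∀ a b → (+ p) ∣ (a * b) → (+ p) ∣ a ⊎ (+ p) ∣ b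
  euclidℤ p-prime a b p∣ab with euclidsLemma (abs a) (abs b) p-prime (subst (_ ℕ∣.∣_) (ℤP.abs-* a b) (∣⇒∣ᵤ p∣ab))
  ... | inj₁ p∣a = inj₁ (∣ᵤ⇒∣ p∣a)
  ... | inj₂ p∣b = inj₂ (∣ᵤ⇒∣ p∣b)

  natural-representative : ∀ n .{{_ : NonZero n}} → ∀ z → ∃ λ t → + t ≋[ + n ] z
  natural-representative n (+ k) = k , ≋-refl
  natural-representative n@(suc n-1) -[1+ k ] = suc k ℕ.* n-1 , mk≋ (divides (+ suc k) (begin
      + (suc k ℕ.* n-1) - -[1+ k ]    ≡⟨ cong (_- -[1+ k ]) (ℤP.pos-* (suc k) n-1) ⟩
      + suc k * + n-1 + + suc k       ≡⟨ factor (+ suc k) (+ n-1) ⟩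
      + suc k * (+ 1 + + n-1)         ∎))
    where
    open ≡-Reasoning
    factor : ∀ a b → a * b + a ≡ a * (+ 1 + b)
    factor = solve-∀

  module _ {p : ℕ} (p-prime : Prime p) where

    private instance
      p≢0 : NonZero p
      p≢0 = prime⇒nonZero p-prime

    p-part : ∀ N .{{_ : NonZero N}} → ∃₂ λ e m → N ≡ p ℕ.^ e ℕ.* m × ¬ p ∣ℕ m
    p-part N = bounded N N ℕP.≤-refl
      where
      bounded : ∀ bound N → N ≤ bound → .{{NonZero N}} → ∃₂ λ e m → N ≡ p ℕ.^ e ℕ.* m × ¬ p ∣ℕ m
      bounded bound N N≤bound with p ℕ∣.∣? N
      ... | no p∤N = 0 , N , sym (ℕP.+-identityʳ N) , p∤N
      bounded zero N N≤0 | yes _ = ⊥-elim (ℕ.≢-nonZero⁻¹ N (ℕP.n≤0⇒n≡0 N≤0))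
      bounded (suc bound) N N≤1+bound | yes (ℕ∣.divides N′ N≡N′p)
        with bounded bound N′ N′≤bound {{N′≢0}}
        where
        N′≢0 : NonZero N′
        N′≢0 = ℕ.≢-nonZero (λ { refl → ℕ.≢-nonZero⁻¹ N N≡N′p })
        N′≤bound : N′ ≤ bound
        N′≤bound = ℕP.≤-pred (ℕP.≤-trans (subst (N′ <_) (sym N≡N′p) (ℕP.m<m*n N′ p {{N′≢0}} (ℕ.nonTrivial⇒n>1 p {{prime⇒nonTrivial p-prime}}))) N≤1+bound)
      ... | e , m , N′≡pᵉm , p∤m = suc e , m , N≡pᵉ⁺¹m , p∤m
        where
        N≡pᵉ⁺¹m : N ≡ p ℕ.^ suc e ℕ.* m
        N≡pᵉ⁺¹m = trans N≡N′p (trans (cong (ℕ._* p) N′≡pᵉm)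
                    (trans (ℕP.*-comm (p ℕ.^ e ℕ.* m) p) (sym (ℕP.*-assoc p (p ℕ.^ e) m))))

    coprime-p : ∀ {d} → ¬ p ∣ℕ d → Coprime d p
    coprime-p p∤d {k} (k∣d , k∣p) with prime⇒irreducible p-prime k∣p
    ... | inj₁ k≡1 = k≡1
    ... | inj₂ refl = ⊥-elim (p∤d k∣d)

    coprime-pᵉ : ∀ {d} → ¬ p ∣ℕ d → ∀ e → Coprime d (p ℕ.^ e)
    coprime-pᵉ p∤d zero (_ , i∣1) = ℕ∣.∣1⇒≡1 i∣1
    coprime-pᵉ p∤d (suc e) (i∣d , i∣pᵉ⁺¹) =
      coprime-pᵉ p∤d e (i∣d , coprime-divisor (coprime-p (λ p∣i → p∤d (ℕ∣.∣-trans p∣i i∣d))) i∣pᵉ⁺¹)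

    inverse-mod-pᵉ : ∀ {d} → ¬ p ∣ℕ d → ∀ e → ∃ λ u → u * + d ≋[ + (p ℕ.^ e) ] + 1
    inverse-mod-pᵉ {d} p∤d e with coprime-Bézout (coprime-pᵉ p∤d e)
    ... | Bézout.+- x y 1+yP≡xd = + x , mk≋ (divides (+ y) (begin
          + x * + d - + 1            ≡⟨ cong (_- + 1) (ℤP.pos-* x d) ⟨
          + (x ℕ.* d) - + 1          ≡⟨ cong (λ z → + z - + 1) 1+yP≡xd ⟨
          + (1 ℕ.+ y ℕ.* P) - + 1    ≡⟨ cong (_- + 1) (ℤP.pos-+ 1 (y ℕ.* P)) ⟩
          + 1 + + (y ℕ.* P) - + 1    ≡⟨ cancel (+ (y ℕ.* P)) ⟩
          + (y ℕ.* P)                ≡⟨ ℤP.pos-* y P ⟩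
          + y * + P                  ∎))
      where
      open ≡-Reasoning
      P : ℕ
      P = p ℕ.^ e
      cancel : ∀ a → + 1 + a - + 1 ≡ a
      cancel = solve-∀
    ... | Bézout.-+ x y 1+xd≡yP = - + x , mk≋ (divides (- + y) (begin
          - + x * + d - + 1          ≡⟨ regroup (+ x) (+ d) ⟩
          - (+ 1 + + x * + d)        ≡⟨ cong (λ z → - (+ 1 + z)) (ℤP.pos-* x d) ⟨
          - + (1 ℕ.+ x ℕ.* d)        ≡⟨ cong (λ z → - + z) 1+xd≡yP ⟩
          - + (y ℕ.* P)              ≡⟨ cong -_ (ℤP.pos-* y P) ⟩
          - (+ y * + P)              ≡⟨ ℤP.neg-distribˡ-* (+ y) (+ P) ⟩
          - + y * + P                ∎))
      where
      open ≡-Reasoning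
      P : ℕ
      P = p ℕ.^ e
      regroup : ∀ a b → - a * b - + 1 ≡ - (+ 1 + a * b)
      regroup = solve-∀

    solve-t·d≡m·j : ∀ N .{{_ : NonZero N}} → p ∣ℕ N → ∀ e m → N ≡ p ℕ.^ e ℕ.* m → ¬ p ∣ℕ m →
                    ∀ d → ¬ p ∣ℕ d → ∀ j → ¬ (+ p) ∣ j →
                    ∃ λ t → ¬ p ∣ℕ t × + t * + d ≋[ + N ] + m * j
    solve-t·d≡m·j N p∣N e m N≡pᵉm p∤m d p∤d j p∤j = t , p∤t , t·d≈m·j
      where
      u : ℤ
      u = proj₁ (inverse-mod-pᵉ p∤d e)
      m·ud≈m : + m * (u * + d) ≋[ + N ] + m * + 1
      m·ud≈m = subst (λ k → + m * (u * + d) ≋[ k ] + m * + 1)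
                 (trans (sym (ℤP.pos-* m (p ℕ.^ e))) (cong +_ (trans (ℕP.*-comm m (p ℕ.^ e)) (sym N≡pᵉm))))
                 (≋-scale (+ m) (proj₂ (inverse-mod-pᵉ p∤d e)))
      rep : ∃ λ t → + t ≋[ + N ] + m * u * j
      rep = natural-representative N (+ m * u * j)
      t : ℕ
      t = proj₁ rep
      t≈muj : + t ≋[ + N ] + m * u * j
      t≈muj = proj₂ rep
      t·d≈m·j : + t * + d ≋[ + N ] + m * j
      t·d≈m·j = ≋-trans (≋-*ʳ (+ d) t≈muj) (≋-trans (≋-reflexive (regroup (+ m) u j (+ d)))
                  (≋-trans (≋-*ˡ j m·ud≈m) (≋-reflexive (swap j (+ m)))))
        where
        regroup : ∀ m u j d → m * u * j * d ≡ j * (m * (u * d))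
        regroup = solve-∀
        swap : ∀ j m → j * (m * + 1) ≡ m * j
        swap = solve-∀
      -- modulo p, m·j ≡ t·d ≡ 0 if p ∣ t
      p∣t⇒p∣m·j : p ∣ℕ t → (+ p) ∣ (+ m * j)
      p∣t⇒p∣m·j p∣t = ≋0⇒∣ (≋-trans (≋-sym (mod-p t·d≈m·j)) (∣⇒≋0 p∣t·d))
        where
        mod-p : ∀ {a b} → a ≋[ + N ] b → a ≋[ + p ] b
        mod-p = ≋-weaken (∣ᵤ⇒∣ {+ p} {+ N} p∣N)
        p∣t·d : (+ p) ∣ (+ t * + d)
        p∣t·d = ∣m⇒∣m*n (+ d) (∣ᵤ⇒∣ {+ p} {+ t} p∣t)
      p∤t : ¬ p ∣ℕ t
      p∤t p∣t = [ (λ p∣m → p∤m (∣⇒∣ᵤ p∣m)) , p∤j ]′ (euclidℤ p-prime (+ m) j (p∣t⇒p∣m·j p∣t))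

open import Defs
open import Data.Nat using (_%_)
open import Data.Nat.Divisibility using (_∣_)
open import Data.Fin using (Fin; toℕ)
open import Data.Fin.Subset using (_∈_; _∉_; ∣_∣)
open import Data.Product using (_×_; _,_)
open import Relation.Binary.PropositionalEquality using (_≡_)
open import Relation.Nullary using (¬_)
open import Function.Bundles using (_⇔_; mk⇔)

-- If p ∣ n, |S| = p and the elements of S are pairwise
-- incongruent modulo p, then S meets every residue class mod p exactly once,
-- and the multiples of p form a total perfect code: the neighbour of v in
-- the code is v + s for the unique s ∈ S with s ≡ -v (mod p).
module Sufficiency (n p : ℕ) .{{_ : NonZero n}} .{{_ : NonZero p}} (p∣n : p ∣ n)
                   (S : Subset n) (∣S∣≡p : ∣ S ∣ ≡ p)
                   (incongruent : ∀ s s' → s ∈ S → s' ∈ S → ¬ (s ≡ s') → ¬ (toℕ s % p ≡ toℕ s' % p)) where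

  open import Data.Nat using (_*_; _≤_)
  import Data.Nat.Properties as ℕP
  open import Data.Nat.DivMod using (_mod_)
  open import Data.Nat.Divisibility using (_∣?_)
  open import Data.Integer using (+_; _+_; _-_; -_)
  import Data.Integer.Properties as ℤP
  open import Data.Integer.Divisibility.Signed using (∣ᵤ⇒∣; ∣⇒∣ᵤ)
  import Data.Fin.Properties as FP
  open import Data.Product using (∃; _×_; _,_)
  open import Data.Empty using (⊥-elim)
  open import Relation.Nullary using (yes; no)
  open import Relation.Binary.PropositionalEquality
  open import Defs
  open IntegerCongruence
  open CyclicGroup n
  open FiniteSums
  open Subsets

  mod-p : ∀ {a b} → a ≈n b → a ≋[ + p ] b
  mod-p = ≋-weaken (∣ᵤ⇒∣ {+ p} {+ n} p∣n)

  residue : Fin n → Fin p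
  residue s = toℕ s mod p

  toℕ-residue : ∀ s → toℕ (residue s) ≡ toℕ s % p
  toℕ-residue s = FP.toℕ-fromℕ< _

  residue≡⇒≋ : ∀ {s x} → residue s ≡ residue x → ι s ≋[ + p ] ι x
  residue≡⇒≋ {s} {x} eq = %⇒≋ p (toℕ s) (toℕ x) (trans (sym (toℕ-residue s)) (trans (cong toℕ eq) (toℕ-residue x)))

  ≋⇒residue≡ : ∀ {s x} → ι s ≋[ + p ] ι x → residue s ≡ residue x
  ≋⇒residue≡ {s} {x} s≋x = FP.toℕ-injective (trans (toℕ-residue s) (trans (≋⇒% p (toℕ s) (toℕ x) s≋x) (sym (toℕ-residue x))))

  residue-injective : ∀ {s s'} → s ∈ S → s' ∈ S → residue s ≡ residue s' → s ≡ s'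
  residue-injective {s} {s'} s∈S s'∈S eq with s FP.≟ s'
  ... | yes s≡s' = s≡s'
  ... | no s≢s' = ⊥-elim (incongruent s s' s∈S s'∈S s≢s'
                    (trans (sym (toℕ-residue s)) (trans (cong toℕ eq) (toℕ-residue s'))))

  classSize : Fin p → ℕ
  classSize r = Σ (λ s → χ S s * 𝟙 (r FP.≟ residue s))

  Σ-classSize : Σ classSize ≡ p
  Σ-classSize = begin
      Σ (λ r → Σ (λ s → χ S s * 𝟙 (r FP.≟ residue s)))  ≡⟨ ∑-comm (λ r s → χ S s * 𝟙 (r FP.≟ residue s)) ⟩
      Σ (λ s → Σ (λ r → χ S s * 𝟙 (r FP.≟ residue s)))  ≡⟨ sum-cong-≗ (λ s → *-distribˡ-sum (χ S s) (λ r → 𝟙 (r FP.≟ residue s))) ⟨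
      Σ (λ s → χ S s * Σ (λ r → 𝟙 (r FP.≟ residue s)))  ≡⟨ sum-cong-≗ (λ s → trans (cong (χ S s *_) (Σ-𝟙 (residue s))) (ℕP.*-identityʳ (χ S s))) ⟩
      Σ (χ S)                                           ≡⟨ ∣S∣≡Σχ S ⟨
      ∣ S ∣                                             ≡⟨ ∣S∣≡p ⟩
      p                                                 ∎
    where open ≡-Reasoning

  in-class : ∀ r {s} → 1 ≤ χ S s * 𝟙 (r FP.≟ residue s) → s ∈ S × r ≡ residue s
  in-class r {s} pos with *-pos {χ S s} pos
  ... | 1≤χ , 1≤𝟙 = χ-pos 1≤χ , 𝟙-pos (r FP.≟ residue s) 1≤𝟙

  classSize≤1 : ∀ r → classSize r ≤ 1
  classSize≤1 r = Σ≤1 _ (λ s → ℕP.*-mono-≤ (χ≤1 S s) (𝟙≤1 (r FP.≟ residue s))) at-most-one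
    where
    at-most-one : ∀ s s' → 1 ≤ χ S s * 𝟙 (r FP.≟ residue s) → 1 ≤ χ S s' * 𝟙 (r FP.≟ residue s') → s ≡ s'
    at-most-one s s' pos pos' with in-class r pos | in-class r pos'
    ... | s∈S , r≡ | s'∈S , r≡' = residue-injective s∈S s'∈S (trans (sym r≡) r≡')

  -- … hence, with p classes and p elements, exactly once
  classSize≡1 : ∀ r → classSize r ≡ 1
  classSize≡1 = Σ-mono-tight classSize (λ _ → 1) classSize≤1 (ℕP.≤-reflexive (trans (Σ-1 p) (sym Σ-classSize)))

  S-meets : ∀ r → ∃ λ s → s ∈ S × residue s ≡ r
  S-meets r with Σ-pos (λ s → χ S s * 𝟙 (r FP.≟ residue s)) (ℕP.≤-reflexive (sym (classSize≡1 r)))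
  ... | s , pos with in-class r pos
  ...   | s∈S , r≡ = s , s∈S , sym r≡

  C : Subset n
  C = ⟦ (λ c → p ∣? toℕ c) ⟧

  ≋0⇒∈C : ∀ {c} → ι c ≋[ + p ] + 0 → c ∈ C
  ≋0⇒∈C c≋0 = ⇒∈⟦⟧ (λ c → p ∣? toℕ c) (∣⇒∣ᵤ (≋0⇒∣ c≋0))

  ∈C⇒≋0 : ∀ {c} → c ∈ C → ι c ≋[ + p ] + 0
  ∈C⇒≋0 c∈C = ∣⇒≋0 (∣ᵤ⇒∣ (∈⟦⟧⇒ (λ c → p ∣? toℕ c) c∈C))

  neighbour≋-v : ∀ v {c} → c ∈ C → ι (c -ₙ v) ≋[ + p ] - ι v
  neighbour≋-v v {c} c∈C = begin
      ι (c -ₙ v)     ≈⟨ mod-p (ι-- c v) ⟩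
      ι c - ι v      ≈⟨ ≋-- (∈C⇒≋0 c∈C) (≋-refl {a = ι v}) ⟩
      + 0 - ι v      ≡⟨ ℤP.+-identityˡ (- ι v) ⟩
      - ι v          ∎
    where open import Relation.Binary.Reasoning.Setoid (≋-setoid {+ p})

  -- the neighbour of v in C is v + s for the s ∈ S in the class of -v
  code : TotalPerfectCode S C
  code v with S-meets (residue (-ₙ v))
  ... | s , s∈S , s≡-v = v +ₙ s , (v+s∈C , v~v+s) , unique
    where
    s≋-v : ι s ≋[ + p ] - ι v
    s≋-v = ≋-trans (residue≡⇒≋ s≡-v) (mod-p (ι-neg v))
    v+s∈C : (v +ₙ s) ∈ C
    v+s∈C = ≋0⇒∈C (≋-trans (mod-p (ι-+ v s)) (≋-trans (≋-+ (≋-refl {a = ι v}) s≋-v) (≋-reflexive (ℤP.+-inverseʳ (ι v)))))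
    v~v+s : Adj S v (v +ₙ s)
    v~v+s = subst (_∈ S) (sym ([a+b]-a≡b v s)) s∈S
    unique : ∀ {c} → c ∈ C × Adj S v c → v +ₙ s ≡ c
    unique {c} (c∈C , v~c) = trans (cong (v +ₙ_) s≡c-v) (a+[x-a]≡x v c)
      where
      s≡c-v : s ≡ c -ₙ v
      s≡c-v = residue-injective s∈S v~c (≋⇒residue≡ (≋-trans s≋-v (≋-sym (neighbour≋-v v c∈C))))

-- A total perfect code C yields the tiling S ⊕ C = ℤ_n, so
-- |S|·|C| = n and p ∣ n; by the multiplier theorem t·S ⊕ C = ℤ_n for every
-- t prime to p.  Connectivity provides s ∈ S with p ∤ s, so s ≠ -s and
-- d = 2s is prime to p.  Write n = p^e·m with p ∤ m and, for r < p,
-- decompose g_r = r·m·s - r·m·(-s) as m·a_r + b_r (a_r ∈ S, b_r ∈ C).  If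
-- a_r ≡ a_r' (mod p) with r ≠ r', a multiplier t prime to p solves
-- t·d ≡ m·((r - r')·d - (a_r - a_r')) (mod n), and then t·s + b_r' and
-- t·(-s) + b_r are two representations of the same element in t·S ⊕ C.
-- Hence r ↦ a_r is injective, so onto S, and S is incongruent mod p.
module Necessity (n p : ℕ) .{{_ : NonZero n}} .{{_ : NonZero p}} (p-prime : Prime p) (p-odd : ¬ 2 ∣ p)
                 (S : Subset n) (inv : InverseClosed S) (∣S∣≡p : ∣ S ∣ ≡ p) (conn : Connected S)
                 (C : Subset n) (code : TotalPerfectCode S C) where

  open import Data.Nat as ℕ using (zero; suc)
  import Data.Nat.Properties as ℕP
  open import Data.Nat.DivMod using (_mod_)
  open import Data.Nat.Divisibility as ℕ∣ using (divides; _∣?_)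
  open import Data.Nat.Coprimality using (Coprime)
  open import Data.Nat.Primality using (euclidsLemma; prime⇒irreducible; prime[2]; ¬prime[1])
  open import Data.Integer using (ℤ; +_; _+_; _-_; _*_; -_)
  import Data.Integer.Properties as ℤP
  open import Data.Integer.Divisibility.Signed as ℤ∣ using (∣ᵤ⇒∣; ∣⇒∣ᵤ)
  open import Data.Integer.Tactic.RingSolver using (solve-∀)
  import Data.Fin.Properties as FP
  open import Data.Fin.Subset.Properties using (_∈?_)
  open import Data.Product using (∃; _×_; _,_; proj₁; proj₂)
  open import Data.Sum using (inj₁; inj₂; [_,_]′)
  open import Data.Empty using (⊥; ⊥-elim)
  open import Relation.Nullary using (yes; no; ¬?)
  open import Relation.Nullary.Decidable using (_×-dec_)
  open import Relation.Binary.PropositionalEquality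
  open import Relation.Binary.Construct.Closure.ReflexiveTransitive using (Star; ε; _◅_)
  open IntegerCongruence
  open CyclicGroup n
  open FiniteSums
  open Subsets
  open GroupSemiring n using (Σ-reflect)
  open Tiling n S C
  open SolvingCongruences

  -- g = a + c with a ∈ S, c ∈ C exactly when c is the code neighbour of g,
  -- so every g has exactly one representation: S ⊕ C = ℤ_n
  S⊕C : Tiles (λ a → a)
  S⊕C g = begin
      Σ (λ a → χ S a ℕ.* χ C (g -ₙ a))                  ≡⟨ Σ-reflect g (λ a → χ S a ℕ.* χ C (g -ₙ a)) ⟩
      Σ (λ c → χ S (g -ₙ c) ℕ.* χ C (g -ₙ (g -ₙ c)))    ≡⟨ sum-cong-≗ term ⟩
      Σ (λ c → 𝟙 (c FP.≟ c₀))                        ≡⟨ Σ-𝟙 c₀ ⟩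
      1                                               ∎
    where
    open ≡-Reasoning
    c₀ : Fin n
    c₀ = proj₁ (code g)
    c₀∈C : c₀ ∈ C
    c₀∈C = proj₁ (proj₁ (proj₂ (code g)))
    g~c₀ : Adj S g c₀
    g~c₀ = proj₂ (proj₁ (proj₂ (code g)))
    c₀-unique : ∀ {c} → c ∈ C × Adj S g c → c₀ ≡ c
    c₀-unique = proj₂ (proj₂ (code g))
    -- g - c ∈ S iff c - g ∈ S, as S = -S
    flip : ∀ {x y} → (y -ₙ x) ∈ S → (x -ₙ y) ∈ S
    flip {x} {y} y-x∈S = subst (_∈ S) (-[x-y]≡y-x y x) (inv _ y-x∈S)
    term : ∀ c → χ S (g -ₙ c) ℕ.* χ C (g -ₙ (g -ₙ c)) ≡ 𝟙 (c FP.≟ c₀)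
    term c = trans (cong (λ x → χ S (g -ₙ c) ℕ.* χ C x) (x-[x-y]≡y g c))
               (trans (𝟙-× ((g -ₙ c) ∈? S) (c ∈? C))
                 (𝟙-⇔ (((g -ₙ c) ∈? S) ×-dec (c ∈? C)) (c FP.≟ c₀)
                   (λ (g-c∈S , c∈C) → sym (c₀-unique (c∈C , flip g-c∈S)))
                   (λ { refl → flip g~c₀ , c₀∈C })))

  p∣n : p ∣ n
  p∣n = divides ∣ C ∣ (trans (sym (tiles⇒∣A∣*∣B∣≡n (λ a → a) S⊕C)) (trans (cong (ℕ._* ∣ C ∣) ∣S∣≡p) (ℕP.*-comm p ∣ C ∣)))

  t·S⊕C : ∀ t → ¬ p ∣ t → Tiles (λ a → t ·ₙ a)
  t·S⊕C zero p∤0 = ⊥-elim (p∤0 (p ℕ∣.∣0))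
  t·S⊕C t@(suc _) p∤t = multiplier (λ a → a) S⊕C t (subst (Coprime t) (sym ∣S∣≡p) (coprime-p p-prime p∤t))

  mod-p : ∀ {a b} → a ≈n b → a ≋[ + p ] b
  mod-p = ≋-weaken (∣ᵤ⇒∣ {+ p} {+ n} p∣n)

  -- If every element of S were a multiple of p, every vertex reachable from
  -- 0 would be one too; but 1 is reachable.  So S has an element prime to p.
  walk-in-pℤ : (∀ s → s ∈ S → p ∣ toℕ s) → ∀ {u v} → Star (Adj S) u v → ι u ≋[ + p ] + 0 → ι v ≋[ + p ] + 0
  walk-in-pℤ S⊆pℤ ε u≋0 = u≋0
  walk-in-pℤ S⊆pℤ {u} (_◅_ {j = w} u~w w⇝v) u≋0 = walk-in-pℤ S⊆pℤ w⇝v w≋0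
    where
    w≋0 : ι w ≋[ + p ] + 0
    w≋0 = ≋-trans (mod-p (≋-trans (≋-reflexive (cong ι (sym ([y-z]+z≡y w u)))) (ι-+ (w -ₙ u) u)))
            (≋-+ (∣⇒≋0 (∣ᵤ⇒∣ {+ p} {ι (w -ₙ u)} (S⊆pℤ (w -ₙ u) u~w))) u≋0)

  generator : ∃ λ s → s ∈ S × ¬ p ∣ toℕ s
  generator with FP.any? (λ s → (s ∈? S) ×-dec ¬? (p ∣? toℕ s))
  ... | yes found = found
  ... | no none = ⊥-elim (¬prime[1] (subst Prime (ℕ∣.∣1⇒≡1 (∣⇒∣ᵤ (≋0⇒∣ 1≋0))) p-prime))
    where
    S⊆pℤ : ∀ s → s ∈ S → p ∣ toℕ s
    S⊆pℤ s s∈S with p ∣? toℕ s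
    ... | yes p∣s = p∣s
    ... | no p∤s = ⊥-elim (none (s , s∈S , p∤s))
    1≋0 : + 1 ≋[ + p ] + 0
    1≋0 = ≋-trans (≋-sym (mod-p (ι-mod 1))) (walk-in-pℤ S⊆pℤ (conn 0ₙ (1 mod n)) (mod-p ι-0))

  s : Fin n
  s = proj₁ generator

  s∈S : s ∈ S
  s∈S = proj₁ (proj₂ generator)

  p∤s : ¬ p ∣ toℕ s
  p∤s = proj₂ (proj₂ generator)

  s̄ : Fin n
  s̄ = -ₙ s

  s̄∈S : s̄ ∈ S
  s̄∈S = inv s s∈S

  -- d = 2s ≡ s - s̄ is prime to p, because p is odd
  d : ℕ
  d = 2 ℕ.* toℕ s

  p∤d : ¬ p ∣ d
  p∤d p∣2s with euclidsLemma 2 (toℕ s) p-prime p∣2s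
  ... | inj₂ p∣s = p∤s p∣s
  ... | inj₁ p∣2 with prime⇒irreducible prime[2] p∣2
  ...   | inj₁ p≡1 = ¬prime[1] (subst Prime p≡1 p-prime)
  ...   | inj₂ p≡2 = p-odd (subst (_∣ p) p≡2 ℕ∣.∣-refl)

  -- Δ = s - s̄ ≡ d (mod n), and s ≠ s̄ because p ∤ d
  Δ : ℤ
  Δ = ι s - ι s̄

  Δ≈d : Δ ≈n + d
  Δ≈d = ≋-trans (≋-- (≋-refl {a = ι s}) (ι-neg s)) (≋-reflexive (trans (double (ι s)) (sym (ℤP.pos-* 2 (toℕ s)))))
    where
    double : ∀ x → x - - x ≡ + 2 * x
    double = solve-∀

  s≢s̄ : s ≢ s̄
  s≢s̄ s≡s̄ = p∤d (∣⇒∣ᵤ (≋0⇒∣ (mod-p (≋-trans (≋-sym Δ≈d) (≋-reflexive Δ≡0)))))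
    where
    Δ≡0 : Δ ≡ + 0
    Δ≡0 = trans (cong (λ x → ι s - ι x) (sym s≡s̄)) (ℤP.+-inverseʳ (ι s))

  e m : ℕ
  e = proj₁ (p-part p-prime n)
  m = proj₁ (proj₂ (p-part p-prime n))

  n≡pᵉm : n ≡ p ℕ.^ e ℕ.* m
  n≡pᵉm = proj₁ (proj₂ (proj₂ (p-part p-prime n)))

  p∤m : ¬ p ∣ m
  p∤m = proj₂ (proj₂ (proj₂ (p-part p-prime n)))

  g : Fin p → Fin n
  g r = (toℕ r ℕ.* m) ·ₙ s -ₙ (toℕ r ℕ.* m) ·ₙ s̄

  decomposition : ∀ r → ∃ λ a → a ∈ S × (g r -ₙ m ·ₙ a) ∈ C
  decomposition r = tiling-exists (λ a → m ·ₙ a) (t·S⊕C m p∤m) (g r)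

  a : Fin p → Fin n
  a r = proj₁ (decomposition r)

  a∈S : ∀ r → a r ∈ S
  a∈S r = proj₁ (proj₂ (decomposition r))

  b : Fin p → Fin n
  b r = g r -ₙ m ·ₙ a r

  b∈C : ∀ r → b r ∈ C
  b∈C r = proj₂ (proj₂ (decomposition r))

  ι-b : ∀ r → ι (b r) ≈n + toℕ r * + m * Δ - + m * ι (a r)
  ι-b r = begin
      ι (g r -ₙ m ·ₙ a r)                                   ≈⟨ ι-- (g r) (m ·ₙ a r) ⟩
      ι (g r) - ι (m ·ₙ a r)                                ≈⟨ ≋-- (ι-- ((R ℕ.* m) ·ₙ s) ((R ℕ.* m) ·ₙ s̄)) (ι-· m (a r)) ⟩
      ι ((R ℕ.* m) ·ₙ s) - ι ((R ℕ.* m) ·ₙ s̄) - + m * ι (a r) ≈⟨ ≋-- (≋-- (ι-· (R ℕ.* m) s) (ι-· (R ℕ.* m) s̄)) (≋-refl {a = + m * ι (a r)}) ⟩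
      + (R ℕ.* m) * ι s - + (R ℕ.* m) * ι s̄ - + m * ι (a r)  ≡⟨ cong (λ x → x * ι s - x * ι s̄ - + m * ι (a r)) (ℤP.pos-* R m) ⟩
      + R * + m * ι s - + R * + m * ι s̄ - + m * ι (a r)      ≡⟨ factor (+ R * + m) (ι s) (ι s̄) (+ m * ι (a r)) ⟩
      + R * + m * Δ - + m * ι (a r)                          ∎
    where
    open ≈n-Reasoning
    R = toℕ r
    factor : ∀ x y z w → x * y - x * z - w ≡ x * (y - z) - w
    factor = solve-∀

  -- t·s + b r' and t·s̄ + b r can never coincide when p ∤ t: they would be
  -- two different representations in the tiling t·S ⊕ C
  no-two-representations : ∀ t → ¬ p ∣ t → ∀ r r' → + t * ι s + ι (b r') ≈n + t * ι s̄ + ι (b r) → ⊥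
  no-two-representations t p∤t r r' same =
    s≢s̄ (tiling-unique (λ x → t ·ₙ x) (t·S⊕C t p∤t) G s∈S s̄∈S
           (subst (_∈ C) (sym ([a+b]-a≡b (t ·ₙ s) (b r'))) (b∈C r'))
           (subst (_∈ C) (sym G-t·s̄≡b) (b∈C r)))
    where
    G : Fin n
    G = (t ·ₙ s) +ₙ b r'
    G≡t·s̄+b : G ≡ (t ·ₙ s̄) +ₙ b r
    G≡t·s̄+b = ι-inj (begin
        ι ((t ·ₙ s) +ₙ b r')          ≈⟨ ι-+ (t ·ₙ s) (b r') ⟩
        ι (t ·ₙ s) + ι (b r')       ≈⟨ ≋-+ (ι-· t s) (≋-refl {a = ι (b r')}) ⟩
        + t * ι s + ι (b r')        ≈⟨ same ⟩
        + t * ι s̄ + ι (b r)         ≈⟨ ≋-+ (ι-· t s̄) (≋-refl {a = ι (b r)}) ⟨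
        ι (t ·ₙ s̄) + ι (b r)        ≈⟨ ι-+ (t ·ₙ s̄) (b r) ⟨
        ι ((t ·ₙ s̄) +ₙ b r)           ∎)
      where open ≈n-Reasoning
    G-t·s̄≡b : G -ₙ t ·ₙ s̄ ≡ b r
    G-t·s̄≡b = trans (cong (_-ₙ t ·ₙ s̄) G≡t·s̄+b) ([a+b]-a≡b (t ·ₙ s̄) (b r))

  j : Fin p → Fin p → ℤ
  j r r' = (+ toℕ r - + toℕ r') * + d - (ι (a r) - ι (a r'))

  -- if a r ≡ a r' (mod p) for r ≠ r', then j r r' ≡ (r - r')·d ≢ 0 (mod p)
  p∤j : ∀ r r' → r ≢ r' → (+ p) ℤ∣.∣ (ι (a r) - ι (a r')) → ¬ (+ p) ℤ∣.∣ j r r'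
  p∤j r r' r≢r' p∣δ p∣j =
    [ (λ p∣R-R' → r≢r' (FP.toℕ-injective (small-≋⇒≡ p (FP.toℕ<n r) (FP.toℕ<n r') (mk≋ p∣R-R'))))
    , (λ p∣d → p∤d (∣⇒∣ᵤ p∣d)) ]′
    (euclidℤ p-prime (R - R') (+ d) (subst ((+ p) ℤ∣.∣_) (add-back (R - R') (+ d) δ) (ℤ∣.∣m∣n⇒∣m+n p∣j p∣δ)))
    where
    R R' δ : ℤ
    R = + toℕ r
    R' = + toℕ r'
    δ = ι (a r) - ι (a r')
    add-back : ∀ x y z → (x * y - z) + z ≡ x * y
    add-back = solve-∀

  representations-agree : ∀ t r r' → + t * + d ≈n + m * j r r' →
                          + t * ι s + ι (b r') ≈n + t * ι s̄ + ι (b r)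
  representations-agree t r r' t·d≈m·j = diff≋0⇒≋ (begin
      (+ t * ι s + ι (b r')) - (+ t * ι s̄ + ι (b r))
        ≈⟨ ≋-- (≋-+ (≋-refl {a = + t * ι s}) (ι-b r')) (≋-+ (≋-refl {a = + t * ι s̄}) (ι-b r)) ⟩
      (+ t * ι s + (R' * + m * Δ - + m * ι (a r'))) - (+ t * ι s̄ + (R * + m * Δ - + m * ι (a r)))
        ≡⟨ regroup (+ t) (ι s) (ι s̄) _ _ ⟩
      + t * Δ - ((R * + m * Δ - + m * ι (a r)) - (R' * + m * Δ - + m * ι (a r')))
        ≡⟨ cong (λ x → + t * Δ - x) (factor R R' (+ m) Δ (ι (a r)) (ι (a r'))) ⟩
      + t * Δ - + m * ((R - R') * Δ - δ)
        ≈⟨ ≋-- (≋-*ˡ (+ t) Δ≈d) (≋-*ˡ (+ m) (≋-- (≋-*ˡ (R - R') Δ≈d) (≋-refl {a = δ}))) ⟩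
      + t * + d - + m * j r r'
        ≈⟨ ≋-- t·d≈m·j (≋-refl {a = + m * j r r'}) ⟩
      + m * j r r' - + m * j r r'
        ≡⟨ ℤP.+-inverseʳ (+ m * j r r') ⟩
      + 0 ∎)
    where
    open ≈n-Reasoning
    R R' δ : ℤ
    R = + toℕ r
    R' = + toℕ r'
    δ = ι (a r) - ι (a r')
    regroup : ∀ t x y P Q → (t * x + P) - (t * y + Q) ≡ t * (x - y) - (Q - P)
    regroup = solve-∀
    factor : ∀ R R' m D u u' → (R * m * D - m * u) - (R' * m * D - m * u') ≡ m * ((R - R') * D - (u - u'))
    factor = solve-∀

  a-incongruent : ∀ r r' → r ≢ r' → ¬ (+ p) ℤ∣.∣ (ι (a r) - ι (a r'))
  a-incongruent r r' r≢r' p∣δ =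
    no-two-representations (proj₁ solution) (proj₁ (proj₂ solution)) r r'
      (representations-agree (proj₁ solution) r r' (proj₂ (proj₂ solution)))
    where
    solution : ∃ λ t → ¬ p ∣ t × + t * + d ≈n + m * j r r'
    solution = solve-t·d≡m·j p-prime n p∣n e m n≡pᵉm p∤m d p∤d (j r r') (p∤j r r' r≢r' p∣δ)

  a-injective : ∀ r r' → a r ≡ a r' → r ≡ r'
  a-injective r r' ar≡ar' with r FP.≟ r'
  ... | yes r≡r' = r≡r'
  ... | no r≢r' = ⊥-elim (a-incongruent r r' r≢r' (ℤ∣.divides (+ 0) (trans δ≡0 (sym (ℤP.*-zeroˡ (+ p))))))
    where
    δ≡0 : ι (a r) - ι (a r') ≡ + 0
    δ≡0 = trans (cong (λ x → ι (a r) - ι x) (sym ar≡ar')) (ℤP.+-inverseʳ (ι (a r)))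

  -- p indices, injectively into S with |S| = p: every element of S is some a r
  a-onto : ∀ {x} → x ∈ S → ∃ λ r → a r ≡ x
  a-onto = injection-onto S a a∈S a-injective ∣S∣≡p

  incongruent : ∀ s₁ s₂ → s₁ ∈ S → s₂ ∈ S → ¬ (s₁ ≡ s₂) → ¬ (toℕ s₁ % p ≡ toℕ s₂ % p)
  incongruent s₁ s₂ s₁∈S s₂∈S s₁≢s₂ s₁≡s₂[p] =
    a-incongruent r₁ r₂ (λ r₁≡r₂ → s₁≢s₂ (trans (sym ar₁≡s₁) (trans (cong a r₁≡r₂) ar₂≡s₂))) p∣δ
    where
    r₁ r₂ : Fin p
    r₁ = proj₁ (a-onto s₁∈S)
    r₂ = proj₁ (a-onto s₂∈S)
    ar₁≡s₁ : a r₁ ≡ s₁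
    ar₁≡s₁ = proj₂ (a-onto s₁∈S)
    ar₂≡s₂ : a r₂ ≡ s₂
    ar₂≡s₂ = proj₂ (a-onto s₂∈S)
    p∣δ : (+ p) ℤ∣.∣ (ι (a r₁) - ι (a r₂))
    p∣δ = un≋ (subst₂ (λ x y → ι x ≋[ + p ] ι y) (sym ar₁≡s₁) (sym ar₂≡s₂) (%⇒≋ p (toℕ s₁) (toℕ s₂) s₁≡s₂[p]))

theorem1p3 : (n p : ℕ) .{{_ : NonZero n}} .{{_ : NonZero p}} → Prime p → ¬ (2 ∣ p) →
    (S : Subset n) → 0ₙ ∉ S → InverseClosed S → ∣ S ∣ ≡ p → Connected S →
    HasTotalPerfectCode S ⇔
      (p ∣ n × (∀ s s' → s ∈ S → s' ∈ S → ¬ (s ≡ s') → ¬ (toℕ s % p ≡ toℕ s' % p)))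
theorem1p3 n p p-prime p-odd S _ inv ∣S∣≡p conn = mk⇔ necessary sufficient
  where
  necessary : HasTotalPerfectCode S →
              p ∣ n × (∀ s s' → s ∈ S → s' ∈ S → ¬ (s ≡ s') → ¬ (toℕ s % p ≡ toℕ s' % p))
  necessary (C , code) = N.p∣n , N.incongruent
    where module N = Necessity n p p-prime p-odd S inv ∣S∣≡p conn C code
  sufficient : p ∣ n × (∀ s s' → s ∈ S → s' ∈ S → ¬ (s ≡ s') → ¬ (toℕ s % p ≡ toℕ s' % p)) →
               HasTotalPerfectCode S
  sufficient (p∣n , incongruent) = Suf.C , Suf.code
    where module Suf = Sufficiency n p p∣n S ∣S∣≡p incongruent
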